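{- For all integers $k\geq1$ and $n\geq0$, $$ov_k(n)=\frac{k}{2}\,\overline{M[k]}_2(n)-k\,\overline{M[2k]}_2(n),$$ where $ov_k(n)$ is the sum, over all overpartitions $\lambda$ of $n$, of all overlined parts of $\lambda$ that are divisible by $k$, and for $r\geq1$, $\overline{M[r]}_2(n)$ is the coefficient of $q^n$ in $\left.\delta_z^{2}\overline{C[r]}(z;q)\right|_{z=1}$.
   Context: An overpartition of $n$ is a non-increasing sequence of positive integers summing to $n$ in which the first occurrence of each distinct integer may be overlined. Notation: $(a_1,\dots,a_s;q)_\infty=\prod_{i\geq 0}(1-a_1q^i)\cdots(1-a_sq^i)$, $\delta_z=z\frac{d}{dz}$. For $r\geq1$, $$\overline{C[r]}(z;q)=\frac{(-q;q)_\infty\,(q^r;q^r)_\infty}{(q;q)_\infty}\cdot\frac{(q^r;q^r)_\infty}{(zq^r,q^r/z;q^r)_\infty}=\sum_{n\ge0}\sum_{m\in\mathbb{Z}}\overline{M[r]}(m,n)z^mq^n,$$ so $\overline{M[r]}_2(n)=\sum_m m^2\,\overline{M[r]}(m,n)$. -}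

module Defs where

open import Data.Bool using (Bool; true; false; if_then_else_)
open import Data.Nat as ℕ using (ℕ; zero; suc; _∸_; _≥_; _≤_)
open import Data.Nat.Divisibility using (_∣_; _∣?_)
open import Data.Integer as ℤ using (ℤ; +_; -_)
open import Data.Product using (_×_; _,_; proj₁; proj₂)
open import Data.List using (List; []; _∷_; _++_; map; concat; concatMap; upTo; foldr; length)
open import Data.List.Relation.Unary.All using (All; all?)
open import Data.List.Relation.Unary.Linked using (Linked; linked?)
open import Relation.Binary.PropositionalEquality using (_≡_; _≢_)
open import Relation.Nullary using (Dec; yes; no; ¬_; _×-dec_; _→-dec_)
open import Relation.Nullary.Decidable using (⌊_⌋; ¬?)
import Data.Bool.Properties as BoolP

-- A part is a positive integer together with a flag saying whether it is
-- overlined (true) or not (false).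
Part : Set
Part = ℕ × Bool

weight : List Part → ℕ
weight = foldr (λ p s → proj₁ p ℕ.+ s) 0

-- Adjacent-pair condition: non-increasing, and a part may be overlined only
-- if it is the first occurrence of its value, i.e. the previous part (which,
-- the sequence being non-increasing, is the only candidate for an earlier
-- equal value) has a different value.
AdjOK : Part → Part → Set
AdjOK (a , _) (b , ov) = (a ≥ b) × (ov ≡ true → a ≢ b)

adjOK? : ∀ x y → Dec (AdjOK x y)
adjOK? (a , _) (b , ov) = (b ℕ.≤? a) ×-dec ((ov Data.Bool.≟ true) →-dec ¬? (a ℕ.≟ b))
  where import Data.Bool

Positive : Part → Set
Positive (a , _) = 1 ≤ a

IsOverpartition : ℕ → List Part → Set
IsOverpartition n λ′ = All Positive λ′ × Linked AdjOK λ′ × weight λ′ ≡ n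

isOverpartition? : ∀ n λ′ → Dec (IsOverpartition n λ′)
isOverpartition? n λ′ =
  all? (λ p → 1 ℕ.≤? proj₁ p) λ′ ×-dec (linked? adjOK? λ′ ×-dec (weight λ′ ℕ.≟ n))

listsOfLength : {A : Set} → ℕ → List A → List (List A)
listsOfLength zero    _  = [] ∷ []
listsOfLength (suc ℓ) al = concatMap (λ x → map (x ∷_) (listsOfLength ℓ al)) al

-- Candidate lists for overpartitions of n: length ≤ n, entries in {1..n} × Bool.
-- (Every overpartition of n is among them since parts are ≥ 1 and sum to n.)
alphabet : ℕ → List Part
alphabet n = concatMap (λ a → (a , false) ∷ (a , true) ∷ []) (map suc (upTo n))

candidates : ℕ → List (List Part)
candidates n = concatMap (λ ℓ → listsOfLength ℓ (alphabet n)) (upTo (suc n))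

ovPartsDiv : ℕ → List Part → ℕ
ovPartsDiv k [] = 0
ovPartsDiv k ((a , true)  ∷ λ′) = (if ⌊ k ∣? a ⌋ then a else 0) ℕ.+ ovPartsDiv k λ′
ovPartsDiv k ((a , false) ∷ λ′) = ovPartsDiv k λ′

ov : ℕ → ℕ → ℕ
ov k n = foldr (λ λ′ s → (if ⌊ isOverpartition? n λ′ ⌋ then ovPartsDiv k λ′ else 0) ℕ.+ s)
               0 (candidates n)

-- A Laurent polynomial in z, as a formal sum of monomials c·z^e,
-- stored as a list of pairs (e , c).
Laurent : Set
Laurent = List (ℤ × ℤ)

mulL : Laurent → Laurent → Laurent
mulL xs ys = concatMap (λ x → map (λ y → (proj₁ x ℤ.+ proj₁ y , proj₂ x ℤ.* proj₂ y)) ys) xs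

Series : Set
Series = ℕ → Laurent

oneS : Series
oneS zero    = ((+ 0) , (+ 1)) ∷ []
oneS (suc _) = []

addS : Series → Series → Series
addS f g n = f n ++ g n

mulS : Series → Series → Series
mulS f g n = concatMap (λ i → mulL (f i) (g (n ∸ i))) (upTo (suc n))

prodS : List Series → Series
prodS = foldr mulS oneS

monoS : ℤ → ℤ → ℕ → Series
monoS e c k n = if ⌊ n ℕ.≟ k ⌋ then (e , c) ∷ [] else []

-- 1 / (1 - z^e q^k) = Σ_{j≥0} z^{e j} q^{k j}   (k ≥ 1).
geomS : ℤ → ℕ → Series
geomS e k n = concatMap (λ j → if ⌊ (k ℕ.* j) ℕ.≟ n ⌋ then (e ℤ.* (+ j) , + 1) ∷ [] else [])
                        (upTo (suc n))

-- Factors of C̄[r](z;q) with index i ≥ 1: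
--   (1 + q^i) · 1/(1 - q^i)                       from (-q;q)_∞/(q;q)_∞
--   (1 - q^{ri})² · 1/(1 - z q^{ri}) · 1/(1 - z⁻¹ q^{ri})
--                                                 from (q^r;q^r)_∞² / (zq^r, q^r/z; q^r)_∞
factorsC : ℕ → ℕ → List Series
factorsC r i =
    addS oneS (monoS (+ 0) (+ 1) i)
  ∷ geomS (+ 0) i
  ∷ addS oneS (monoS (+ 0) (- + 1) (r ℕ.* i))
  ∷ addS oneS (monoS (+ 0) (- + 1) (r ℕ.* i))
  ∷ geomS (+ 1) (r ℕ.* i)
  ∷ geomS (- + 1) (r ℕ.* i)
  ∷ []

-- Each factor
-- with index i is ≡ 1 mod q^i, so the infinite product's q^n-coefficient is
-- that of the finite product over 1 ≤ i ≤ n.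
coeffC : ℕ → ℕ → Laurent
coeffC r n = prodS (concatMap (factorsC r) (map suc (upTo n))) n

-- δ_z² evaluated at z = 1 on a Laurent polynomial: Σ e² c.
δ²at1 : Laurent → ℤ
δ²at1 = foldr (λ m s → proj₁ m ℤ.* proj₁ m ℤ.* proj₂ m ℤ.+ s) (+ 0)

M2 : ℕ → ℕ → ℤ
M2 r n = δ²at1 (coeffC r n)

module Submission where

-- C̄[r](z;q) is the product over i ≥ 1 of (1+q^i)/(1−q^i) and (1−q^{ri})²/((1−zq^{ri})(1−q^{ri}/z)).
-- The value and the first two z-moments at z = 1 of a product obey the Leibniz rule; each z-dependent block
-- has value 1, first moment 0 (z ↔ 1/z), and second moment 2 Σ_j j q^{rij}, so M̄[r]₂ = 2 P · Σ_{i,j≥1} j q^{rij}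
-- with P = (−q;q)∞/(q;q)∞. Splitting overpartitions by their largest part gives Σ_n ov_k(n) qⁿ =
-- P · Σ_{k∣m} m q^m/(1+q^m), and q^m/(1+q^m) = q^m/(1−q^m) − 2q^{2m}/(1−q^{2m}) turns both sides into the
-- divisor sums Σ_c c·q^{mc}/(1−q^{mc}).

open import Algebra.Bundles using (CommutativeRing; Ring)
import Algebra.Solver.Ring
open import Algebra.Solver.Ring.AlmostCommutativeRing using (fromCommutativeRing; _-Raw-AlmostCommutative⟶_)
open import Algebra.Structures using (IsCommutativeRing)
open import Data.Bool using (Bool; true; false; _∧_; if_then_else_)
open import Data.Empty using (⊥-elim)
open import Data.Fin using (toℕ)
open import Data.Fin.Properties using (toℕ<n; toℕ-inject₁; toℕ-fromℕ)
open import Data.Integer using (ℤ; +_; -_; _+_; _-_) renaming (_*_ to _*ℤ_)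
import Data.Integer.Properties as ℤ
open import Algebra.Properties.Semiring.Sum ℤ.+-*-semiring
  using (sum; sum-cong-≗; ∑-distrib-+; ∑-comm; *-distribˡ-sum; sum-init-last; sum-replicate-zero)
open import Data.Integer.Tactic.RingSolver using (solve-∀)
open import Data.List using (List; []; _∷_; _++_; _∷ʳ_; foldr; map; concatMap; applyUpTo; upTo)
import Data.List.Properties as List
open import Data.List.Relation.Unary.All using (All; []; _∷_)
open import Data.List.Relation.Unary.Linked using (Linked; []; [-]; _∷_)
import Data.List.Relation.Unary.Linked as Linked
open import Data.Maybe using (Maybe; just; nothing)
open import Data.Nat as ℕ using (ℕ; zero; suc; _∸_; _≤_; _<_; _*_; z≤n; s≤s; NonZero)
open import Data.Nat.Divisibility using (_∣?_; divides)
import Data.Nat.Properties as ℕ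
open import Data.Product using (_×_; _,_; proj₁; proj₂)
open import Data.Sum using (inj₁; inj₂)
open import Function.Bundles using (_⇔_; mk⇔; Equivalence)
open import Relation.Binary.PropositionalEquality
import Relation.Binary.Reasoning.Setoid
open import Relation.Binary.Structures using (IsEquivalence)
open import Relation.Nullary using (Dec; yes; no; does; _×-dec_)
open import Relation.Nullary.Decidable using (⌊_⌋; isYes≗does; dec-true; dec-false; does-⇔)

open import Defs

-- Finite sums

sumTo : ℕ → (ℕ → ℤ) → ℤ
sumTo n f = sum {n} (λ i → f (toℕ i))

sumTo-cong-< : ∀ n {f g : ℕ → ℤ} → (∀ i → i < n → f i ≡ g i) → sumTo n f ≡ sumTo n g
sumTo-cong-< n f≡g = sum-cong-≗ (λ i → f≡g (toℕ i) (toℕ<n i))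

sumTo-cong : ∀ n {f g : ℕ → ℤ} → (∀ i → f i ≡ g i) → sumTo n f ≡ sumTo n g
sumTo-cong n f≡g = sumTo-cong-< n (λ i _ → f≡g i)

sumTo-distrib-+ : ∀ n (f g : ℕ → ℤ) → sumTo n (λ i → f i + g i) ≡ sumTo n f + sumTo n g
sumTo-distrib-+ n f g = ∑-distrib-+ {n} (λ i → f (toℕ i)) (λ i → g (toℕ i))

sumTo-*ˡ : ∀ n c (f : ℕ → ℤ) → sumTo n (λ i → c *ℤ f i) ≡ c *ℤ sumTo n f
sumTo-*ˡ n c f = sym (*-distribˡ-sum {n} c (λ i → f (toℕ i)))

sumTo-linear₂ : ∀ n a b (f g : ℕ → ℤ) → sumTo n (λ i → a *ℤ f i + b *ℤ g i) ≡ a *ℤ sumTo n f + b *ℤ sumTo n g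
sumTo-linear₂ n a b f g = trans (sumTo-distrib-+ n (λ i → a *ℤ f i) (λ i → b *ℤ g i))
                                (cong₂ _+_ (sumTo-*ˡ n a f) (sumTo-*ˡ n b g))

sumTo-comm : ∀ m n (F : ℕ → ℕ → ℤ) →
  sumTo m (λ i → sumTo n (F i)) ≡ sumTo n (λ j → sumTo m (λ i → F i j))
sumTo-comm m n F = ∑-comm {m} {n} (λ i j → F (toℕ i) (toℕ j))

sumTo-zero : ∀ n {f : ℕ → ℤ} → (∀ i → i < n → f i ≡ + 0) → sumTo n f ≡ + 0
sumTo-zero n f≡0 = trans (sumTo-cong-< n f≡0) (sum-replicate-zero n)

sumTo-snoc : ∀ n (f : ℕ → ℤ) → sumTo (suc n) f ≡ sumTo n f + f n
sumTo-snoc n f = trans (sum-init-last {n} (λ i → f (toℕ i)))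
  (cong₂ _+_ (sum-cong-≗ {n} (λ i → cong f (toℕ-inject₁ i))) (cong f (toℕ-fromℕ n)))

sumTo-extend : ∀ {m n} (f : ℕ → ℤ) → m ≤ n → (∀ i → m ≤ i → f i ≡ + 0) → sumTo n f ≡ sumTo m f
sumTo-extend {zero}  {n}     f _         f≡0 = sumTo-zero n (λ i _ → f≡0 i z≤n)
sumTo-extend {suc m} {suc n} f (s≤s m≤n) f≡0 =
  cong (λ s → f 0 + s) (sumTo-extend (λ i → f (suc i)) m≤n (λ i m≤i → f≡0 (suc i) (s≤s m≤i)))

sumTo-reverse : ∀ n (f : ℕ → ℤ) → sumTo n f ≡ sumTo n (λ i → f (n ∸ suc i))
sumTo-reverse zero    f = refl
sumTo-reverse (suc n) f = begin
    f 0 + sumTo n (λ i → f (suc i))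
  ≡⟨ cong (λ s → f 0 + s) (sumTo-reverse n (λ i → f (suc i))) ⟩
    f 0 + sumTo n (λ i → f (suc (n ∸ suc i)))
  ≡⟨ ℤ.+-comm (f 0) _ ⟩
    sumTo n (λ i → f (suc (n ∸ suc i))) + f 0
  ≡⟨ cong₂ _+_ (sumTo-cong-< n (λ i i<n → cong f (sym (ℕ.+-∸-assoc 1 i<n))))
               (cong f (sym (ℕ.n∸n≡0 n))) ⟩
    sumTo n (λ i → f (suc n ∸ suc i)) + f (suc n ∸ suc n)
  ≡⟨ sym (sumTo-snoc n (λ i → f (suc n ∸ suc i))) ⟩
    sumTo (suc n) (λ i → f (suc n ∸ suc i)) ∎
  where open ≡-Reasoning

when : Bool → ℤ → ℤ
when b x = if b then x else + 0

when-+ : ∀ b x y → when b (x + y) ≡ when b x + when b y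
when-+ true  x y = refl
when-+ false x y = refl

when-*ʳ : ∀ b c x → when b (c *ℤ x) ≡ c *ℤ when b x
when-*ʳ true  c x = refl
when-*ʳ false c x = sym (ℤ.*-zeroʳ c)

when-*ˡ : ∀ b x y → when b x *ℤ y ≡ when b (x *ℤ y)
when-*ˡ true  x y = refl
when-*ˡ false x y = ℤ.*-zeroˡ y

when-neg : ∀ b x → when b (- x) ≡ - when b x
when-neg true  x = refl
when-neg false x = refl

when-as-* : ∀ b x → when b x ≡ x *ℤ when b (+ 1)
when-as-* true  x = sym (ℤ.*-identityʳ x)
when-as-* false x = sym (ℤ.*-zeroʳ x)

when-0 : ∀ b → when b (+ 0) ≡ + 0
when-0 true  = refl
when-0 false = refl

when-∧ : ∀ b c x → when (b ∧ c) x ≡ when b (when c x)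
when-∧ true  c x = refl
when-∧ false c x = refl

sumTo-when : ∀ n b (f : ℕ → ℤ) → sumTo n (λ i → when b (f i)) ≡ when b (sumTo n f)
sumTo-when n true  f = refl
sumTo-when n false f = sumTo-zero n (λ _ _ → refl)

sumTo-when-< : ∀ {n N} m (f : ℕ → ℤ) → n ≤ N → (∀ i → n ≤ i → f i ≡ + 0) →
  sumTo N (λ i → when (does (i ℕ.<? m)) (f i)) ≡ sumTo m f
sumTo-when-< {n} {N} m f n≤N f≡0 with ℕ.≤-total m N
... | inj₁ m≤N = trans
  (sumTo-extend (λ i → when (does (i ℕ.<? m)) (f i)) m≤N
    (λ i m≤i → cong (λ b → when b (f i)) (dec-false (i ℕ.<? m) (ℕ.≤⇒≯ m≤i))))
  (sumTo-cong-< m (λ i i<m → cong (λ b → when b (f i)) (dec-true (i ℕ.<? m) i<m)))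
... | inj₂ N≤m = trans
  (sumTo-cong-< N (λ i i<N → cong (λ b → when b (f i)) (dec-true (i ℕ.<? m) (ℕ.<-≤-trans i<N N≤m))))
  (sym (sumTo-extend f N≤m (λ i N≤i → f≡0 i (ℕ.≤-trans n≤N N≤i))))

sumTo-when-<-pair : ∀ {n N} a (f g : ℕ → ℤ) → n ≤ N → (∀ i → n ≤ i → f i ≡ + 0) → (∀ i → n ≤ i → g i ≡ + 0) →
  sumTo N (λ i → when (does (i ℕ.<? suc a)) (f i) + when (does (i ℕ.<? a)) (g i)) ≡ sumTo (suc a) f + sumTo a g
sumTo-when-<-pair {N = N} a f g n≤N f≡0 g≡0 =
  trans (sumTo-distrib-+ N (λ i → when (does (i ℕ.<? suc a)) (f i)) (λ i → when (does (i ℕ.<? a)) (g i)))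
        (cong₂ _+_ (sumTo-when-< (suc a) f n≤N f≡0) (sumTo-when-< a g n≤N g≡0))

infix 8 [_≟_]·_

[_≟_]·_ : ℕ → ℕ → ℤ → ℤ
[ i ≟ j ]· x = when (does (i ℕ.≟ j)) x

[≟]-yes : ∀ {i j} x → i ≡ j → [ i ≟ j ]· x ≡ x
[≟]-yes {i} {j} x i≡j = cong (λ b → when b x) (dec-true (i ℕ.≟ j) i≡j)

[≟]-no : ∀ {i j} x → i ≢ j → [ i ≟ j ]· x ≡ + 0
[≟]-no {i} {j} x i≢j = cong (λ b → when b x) (dec-false (i ℕ.≟ j) i≢j)

[≟]-⇔ : ∀ {i j i′ j′} x → (i ≡ j ⇔ i′ ≡ j′) → [ i ≟ j ]· x ≡ [ i′ ≟ j′ ]· x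
[≟]-⇔ {i} {j} {i′} {j′} x eqv = cong (λ b → when b x) (does-⇔ eqv (i ℕ.≟ j) (i′ ℕ.≟ j′))

sumTo-[≟] : ∀ {n a} (f : ℕ → ℤ) → a < n → sumTo n (λ i → [ i ≟ a ]· f i) ≡ f a
sumTo-[≟] {suc n} {zero} f _ = begin
    [ 0 ≟ 0 ]· f 0 + sumTo n (λ i → [ suc i ≟ 0 ]· f (suc i))
  ≡⟨ cong₂ _+_ ([≟]-yes {0} {0} (f 0) refl) (sumTo-zero n (λ i _ → [≟]-no {suc i} {0} (f (suc i)) (λ ()))) ⟩
    f 0 + + 0
  ≡⟨ ℤ.+-identityʳ (f 0) ⟩
    f 0 ∎
  where open ≡-Reasoning
sumTo-[≟] {suc n} {suc a} f (s≤s a<n) = begin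
    [ 0 ≟ suc a ]· f 0 + sumTo n (λ i → [ suc i ≟ suc a ]· f (suc i))
  ≡⟨ cong₂ _+_ ([≟]-no {0} {suc a} (f 0) (λ ()))
               (sumTo-cong n (λ i → [≟]-⇔ {suc i} {suc a} (f (suc i)) (mk⇔ ℕ.suc-injective (cong suc)))) ⟩
    + 0 + sumTo n (λ i → [ i ≟ a ]· f (suc i))
  ≡⟨ ℤ.+-identityˡ _ ⟩
    sumTo n (λ i → [ i ≟ a ]· f (suc i))
  ≡⟨ sumTo-[≟] (λ i → f (suc i)) a<n ⟩
    f (suc a) ∎
  where open ≡-Reasoning

sumTo-[≟]-out : ∀ {n a} (f : ℕ → ℤ) → n ≤ a → sumTo n (λ i → [ i ≟ a ]· f i) ≡ + 0
sumTo-[≟]-out {n} {a} f n≤a = sumTo-zero n (λ i i<n → [≟]-no {i} {a} (f i) (λ { refl → ℕ.<⇒≱ i<n n≤a }))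

∑ₗ : {A : Set} → List A → (A → ℤ) → ℤ
∑ₗ xs f = foldr (λ x s → f x + s) (+ 0) xs

module _ {A : Set} where

  ∑ₗ-++ : ∀ (xs ys : List A) f → ∑ₗ (xs ++ ys) f ≡ ∑ₗ xs f + ∑ₗ ys f
  ∑ₗ-++ []       ys f = sym (ℤ.+-identityˡ _)
  ∑ₗ-++ (x ∷ xs) ys f = trans (cong (λ s → f x + s) (∑ₗ-++ xs ys f)) (sym (ℤ.+-assoc (f x) _ _))

  ∑ₗ-cong : ∀ (xs : List A) {f g} → (∀ x → f x ≡ g x) → ∑ₗ xs f ≡ ∑ₗ xs g
  ∑ₗ-cong []       f≡g = refl
  ∑ₗ-cong (x ∷ xs) f≡g = cong₂ _+_ (f≡g x) (∑ₗ-cong xs f≡g)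

  ∑ₗ-distrib-+ : ∀ (xs : List A) f g → ∑ₗ xs (λ x → f x + g x) ≡ ∑ₗ xs f + ∑ₗ xs g
  ∑ₗ-distrib-+ []       f g = refl
  ∑ₗ-distrib-+ (x ∷ xs) f g = trans (cong (λ s → f x + g x + s) (∑ₗ-distrib-+ xs f g))
                                     (interchange (f x) (g x) _ _)
    where
    interchange : ∀ a b c d → a + b + (c + d) ≡ a + c + (b + d)
    interchange = solve-∀

  ∑ₗ-*ˡ : ∀ (xs : List A) c f → ∑ₗ xs (λ x → c *ℤ f x) ≡ c *ℤ ∑ₗ xs f
  ∑ₗ-*ˡ []       c f = sym (ℤ.*-zeroʳ c)
  ∑ₗ-*ˡ (x ∷ xs) c f = trans (cong (λ s → c *ℤ f x + s) (∑ₗ-*ˡ xs c f)) (sym (ℤ.*-distribˡ-+ c (f x) _))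

  ∑ₗ-linear₂ : ∀ (xs : List A) a b f g → ∑ₗ xs (λ x → a *ℤ f x + b *ℤ g x) ≡ a *ℤ ∑ₗ xs f + b *ℤ ∑ₗ xs g
  ∑ₗ-linear₂ xs a b f g = trans (∑ₗ-distrib-+ xs (λ x → a *ℤ f x) (λ x → b *ℤ g x))
                                (cong₂ _+_ (∑ₗ-*ˡ xs a f) (∑ₗ-*ˡ xs b g))

  ∑ₗ-linear₃ : ∀ (xs : List A) a b c f g h →
    ∑ₗ xs (λ x → a *ℤ f x + b *ℤ g x + c *ℤ h x) ≡ a *ℤ ∑ₗ xs f + b *ℤ ∑ₗ xs g + c *ℤ ∑ₗ xs h
  ∑ₗ-linear₃ xs a b c f g h = trans (∑ₗ-distrib-+ xs (λ x → a *ℤ f x + b *ℤ g x) (λ x → c *ℤ h x))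
                                    (cong₂ _+_ (∑ₗ-linear₂ xs a b f g) (∑ₗ-*ˡ xs c h))

  ∑ₗ-when : ∀ (xs : List A) b f → ∑ₗ xs (λ x → when b (f x)) ≡ when b (∑ₗ xs f)
  ∑ₗ-when xs true  f = refl
  ∑ₗ-when xs false f = ∑ₗ-zero xs
    where
    ∑ₗ-zero : ∀ (xs : List A) → ∑ₗ xs (λ _ → + 0) ≡ + 0
    ∑ₗ-zero []       = refl
    ∑ₗ-zero (x ∷ xs) = trans (ℤ.+-identityˡ _) (∑ₗ-zero xs)

  ∑ₗ-applyUpTo : ∀ n (h : ℕ → A) f → ∑ₗ (applyUpTo h n) f ≡ sumTo n (λ i → f (h i))
  ∑ₗ-applyUpTo zero    h f = refl
  ∑ₗ-applyUpTo (suc n) h f = cong (λ s → f (h 0) + s) (∑ₗ-applyUpTo n (λ i → h (suc i)) f)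

module _ {A B : Set} where

  ∑ₗ-concatMap : ∀ (g : A → List B) (xs : List A) f → ∑ₗ (concatMap g xs) f ≡ ∑ₗ xs (λ x → ∑ₗ (g x) f)
  ∑ₗ-concatMap g []       f = refl
  ∑ₗ-concatMap g (x ∷ xs) f = trans (∑ₗ-++ (g x) (concatMap g xs) f) (cong (λ s → ∑ₗ (g x) f + s) (∑ₗ-concatMap g xs f))

  ∑ₗ-map : ∀ (g : A → B) (xs : List A) f → ∑ₗ (map g xs) f ≡ ∑ₗ xs (λ x → f (g x))
  ∑ₗ-map g []       f = refl
  ∑ₗ-map g (x ∷ xs) f = cong (λ s → f (g x) + s) (∑ₗ-map g xs f)

module _ {A : Set} where

  ∑ₗ-pos : ∀ (xs : List A) (f : A → ℕ) → + foldr (λ x s → f x ℕ.+ s) 0 xs ≡ ∑ₗ xs (λ x → + f x)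
  ∑ₗ-pos []       f = refl
  ∑ₗ-pos (x ∷ xs) f = cong (λ s → + f x + s) (∑ₗ-pos xs f)

-- Formal power series in q

PowerSeries : Set
PowerSeries = ℕ → ℤ

infixl 6 _⊕_
infixl 7 _⊛_
infix  8 ⊝_

_⊕_ : PowerSeries → PowerSeries → PowerSeries
(f ⊕ g) n = f n + g n

⊝_ : PowerSeries → PowerSeries
(⊝ f) n = - f n

_⊛_ : PowerSeries → PowerSeries → PowerSeries
(f ⊛ g) n = sumTo (suc n) (λ i → f i *ℤ g (n ∸ i))

q^_ : ℕ → PowerSeries
(q^ a) n = [ n ≟ a ]· + 1

-- 𝟘 and 𝟙 are literally constant (+ 0) and constant (+ 1), so that the constants con c of the ring solver
-- below denote exactly these series.
constant : ℤ → PowerSeries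
constant c n = [ n ≟ 0 ]· c

𝟘 : PowerSeries
𝟘 = constant (+ 0)

𝟙 : PowerSeries
𝟙 = q^ 0

⊛-cong : ∀ {f f′ g g′} → f ≗ f′ → g ≗ g′ → f ⊛ g ≗ f′ ⊛ g′
⊛-cong f≗f′ g≗g′ n = sumTo-cong (suc n) (λ i → cong₂ _*ℤ_ (f≗f′ i) (g≗g′ (n ∸ i)))

⊕-cong : ∀ {f f′ g g′} → f ≗ f′ → g ≗ g′ → f ⊕ g ≗ f′ ⊕ g′
⊕-cong f≗f′ g≗g′ n = cong₂ _+_ (f≗f′ n) (g≗g′ n)

⊝-cong : ∀ {f f′} → f ≗ f′ → ⊝ f ≗ ⊝ f′
⊝-cong f≗f′ n = cong -_ (f≗f′ n)

⊛-trunc : ∀ n {f f′ g g′} → (∀ i → i ≤ n → f i ≡ f′ i) → (∀ i → i ≤ n → g i ≡ g′ i) →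
  (f ⊛ g) n ≡ (f′ ⊛ g′) n
⊛-trunc n f≡f′ g≡g′ = sumTo-cong-< (suc n)
  (λ i i<1+n → cong₂ _*ℤ_ (f≡f′ i (ℕ.≤-pred i<1+n)) (g≡g′ (n ∸ i) (ℕ.m∸n≤m n i)))

⊛-distribʳ-⊕ : ∀ f g h → (f ⊕ g) ⊛ h ≗ f ⊛ h ⊕ g ⊛ h
⊛-distribʳ-⊕ f g h n = trans
  (sumTo-cong (suc n) {λ i → (f i + g i) *ℤ h (n ∸ i)} (λ i → ℤ.*-distribʳ-+ (h (n ∸ i)) (f i) (g i)))
  (sumTo-distrib-+ (suc n) (λ i → f i *ℤ h (n ∸ i)) (λ i → g i *ℤ h (n ∸ i)))

⊛-distribˡ-⊕ : ∀ f g h → f ⊛ (g ⊕ h) ≗ f ⊛ g ⊕ f ⊛ h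
⊛-distribˡ-⊕ f g h n = trans
  (sumTo-cong (suc n) {λ i → f i *ℤ (g (n ∸ i) + h (n ∸ i))} (λ i → ℤ.*-distribˡ-+ (f i) (g (n ∸ i)) (h (n ∸ i))))
  (sumTo-distrib-+ (suc n) (λ i → f i *ℤ g (n ∸ i)) (λ i → f i *ℤ h (n ∸ i)))

⊛-comm : ∀ f g → f ⊛ g ≗ g ⊛ f
⊛-comm f g n = trans (sumTo-reverse (suc n) (λ i → f i *ℤ g (n ∸ i))) (sumTo-cong-< (suc n) λ i i<1+n →
  trans (ℤ.*-comm (f (n ∸ i)) (g (n ∸ (n ∸ i))))
        (cong (λ j → g j *ℤ f (n ∸ i)) (ℕ.m∸[m∸n]≡n (ℕ.≤-pred i<1+n))))

⊛-assoc : ∀ f g h → (f ⊛ g) ⊛ h ≗ f ⊛ (g ⊛ h)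
⊛-assoc f g h zero = reassoc (f 0) (g 0) (h 0)
  where
  reassoc : ∀ a b c → (a *ℤ b + + 0) *ℤ c + + 0 ≡ a *ℤ (b *ℤ c + + 0) + + 0
  reassoc = solve-∀
⊛-assoc f g h (suc n) = begin
    (f ⊛ g) 0 *ℤ h (suc n) + ((f₀g⁺ ⊕ f⁺ ⊛ g) ⊛ h) n
  ≡⟨ cong (λ s → (f ⊛ g) 0 *ℤ h (suc n) + s) (⊛-distribʳ-⊕ f₀g⁺ (f⁺ ⊛ g) h n) ⟩
    (f ⊛ g) 0 *ℤ h (suc n) + ((f₀g⁺ ⊛ h) n + ((f⁺ ⊛ g) ⊛ h) n)
  ≡⟨ cong₂ (λ s t → (f ⊛ g) 0 *ℤ h (suc n) + (s + t))
           (trans (sumTo-cong (suc n) {λ i → f 0 *ℤ g (suc i) *ℤ h (n ∸ i)} (λ i → ℤ.*-assoc (f 0) (g (suc i)) (h (n ∸ i))))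
                  (sumTo-*ˡ (suc n) (f 0) (λ i → g (suc i) *ℤ h (n ∸ i))))
           (⊛-assoc f⁺ g h n) ⟩
    (f ⊛ g) 0 *ℤ h (suc n) + (f 0 *ℤ (g⁺ ⊛ h) n + (f⁺ ⊛ (g ⊛ h)) n)
  ≡⟨ regroup (f 0) (g 0) (h (suc n)) _ _ ⟩
    f 0 *ℤ (g 0 *ℤ h (suc n) + (g⁺ ⊛ h) n) + (f⁺ ⊛ (g ⊛ h)) n ∎
  where
  open ≡-Reasoning
  f⁺ g⁺ f₀g⁺ : PowerSeries
  f⁺ i = f (suc i)
  g⁺ i = g (suc i)
  f₀g⁺ i = f 0 *ℤ g (suc i)
  regroup : ∀ a b c d e → (a *ℤ b + + 0) *ℤ c + (a *ℤ d + e) ≡ a *ℤ (b *ℤ c + d) + e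
  regroup = solve-∀

𝟙-⊛ : ∀ f → 𝟙 ⊛ f ≗ f
𝟙-⊛ f n = trans (cong₂ _+_ (ℤ.*-identityˡ (f n)) (sumTo-zero n (λ _ _ → refl))) (ℤ.+-identityʳ (f n))

𝟘-at : ∀ n → 𝟘 n ≡ + 0
𝟘-at n = when-0 (does (n ℕ.≟ 0))

≗-isEquivalence : IsEquivalence (_≗_ {A = ℕ} {B = ℤ})
≗-isEquivalence = record
  { refl  = λ _ → refl
  ; sym   = λ f≗g n → sym (f≗g n)
  ; trans = λ f≗g g≗h n → trans (f≗g n) (g≗h n)
  }

PowerSeries-isCommutativeRing : IsCommutativeRing _≗_ _⊕_ _⊛_ ⊝_ 𝟘 𝟙
PowerSeries-isCommutativeRing = record
  { isRing = record
    { +-isAbelianGroup = record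
      { isGroup = record
        { isMonoid = record
          { isSemigroup = record
            { isMagma = record
              { isEquivalence = ≗-isEquivalence
              ; ∙-cong = λ f≗f′ g≗g′ n → cong₂ _+_ (f≗f′ n) (g≗g′ n) }
            ; assoc = λ f g h n → ℤ.+-assoc (f n) (g n) (h n) }
          ; identity = (λ f n → trans (cong (_+ f n) (𝟘-at n)) (ℤ.+-identityˡ (f n)))
                     , (λ f n → trans (cong (λ z → f n + z) (𝟘-at n)) (ℤ.+-identityʳ (f n))) }
        ; inverse = (λ f n → trans (ℤ.+-inverseˡ (f n)) (sym (𝟘-at n)))
                  , (λ f n → trans (ℤ.+-inverseʳ (f n)) (sym (𝟘-at n)))
        ; ⁻¹-cong = λ f≗g n → cong -_ (f≗g n) }
      ; comm = λ f g n → ℤ.+-comm (f n) (g n) }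
    ; *-cong = ⊛-cong
    ; *-assoc = ⊛-assoc
    ; *-identity = 𝟙-⊛ , (λ f n → trans (⊛-comm f 𝟙 n) (𝟙-⊛ f n))
    ; distrib = ⊛-distribˡ-⊕
              , (λ h f g → ⊛-distribʳ-⊕ f g h) }
  ; *-comm = ⊛-comm }

PowerSeries-commutativeRing : CommutativeRing _ _
PowerSeries-commutativeRing = record { isCommutativeRing = PowerSeries-isCommutativeRing }

constant-⊛ : ∀ c f → constant c ⊛ f ≗ (λ n → c *ℤ f n)
constant-⊛ c f n = trans (sumTo-cong (suc n) {λ i → ([ i ≟ 0 ]· c) *ℤ f (n ∸ i)} (λ i → when-*ˡ (does (i ℕ.≟ 0)) c (f (n ∸ i))))
                         (sumTo-[≟] {suc n} {0} (λ i → c *ℤ f (n ∸ i)) (s≤s z≤n))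

constant-isMorphism : Ring.rawRing ℤ.+-*-ring -Raw-AlmostCommutative⟶ fromCommutativeRing PowerSeries-commutativeRing
constant-isMorphism = record
  { ⟦_⟧    = constant
  ; +-homo = λ c d n → when-+ (does (n ℕ.≟ 0)) c d
  ; *-homo = λ c d n → sym (trans (constant-⊛ c (constant d) n) (sym (when-*ʳ (does (n ℕ.≟ 0)) c d)))
  ; -‿homo = λ c n → when-neg (does (n ℕ.≟ 0)) c
  ; 0-homo = λ n → refl
  ; 1-homo = λ n → refl
  }

constant-≟ : ∀ c d → Maybe (constant c ≗ constant d)
constant-≟ c d with c ℤ.≟ d
... | yes refl = just (λ _ → refl)
... | no _     = nothing

module PowerSeries-solver =
  Algebra.Solver.Ring (Ring.rawRing ℤ.+-*-ring) (fromCommutativeRing PowerSeries-commutativeRing) constant-isMorphism constant-≟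

∑ˢ : ℕ → (ℕ → PowerSeries) → PowerSeries
∑ˢ n F t = sumTo n (λ i → F i t)

∑ˢ-snoc : ∀ n F → ∑ˢ (suc n) F ≗ ∑ˢ n F ⊕ F n
∑ˢ-snoc n F t = sumTo-snoc n (λ i → F i t)

shifts : (ℕ → PowerSeries) → ℕ → PowerSeries
shifts X a = ∑ˢ a (λ i → q^ suc i ⊛ X i)

shifts-suc : ∀ X a → shifts X (suc a) ≗ shifts X a ⊕ q^ suc a ⊛ X a
shifts-suc X a = ∑ˢ-snoc a (λ i → q^ suc i ⊛ X i)

q^-⊛ : ∀ a f n → (q^ a ⊛ f) n ≡ when (does (a ℕ.≤? n)) (f (n ∸ a))
q^-⊛ a f n = trans
  (sumTo-cong (suc n) {λ i → ([ i ≟ a ]· + 1) *ℤ f (n ∸ i)}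
    (λ i → trans (when-*ˡ (does (i ℕ.≟ a)) (+ 1) (f (n ∸ i))) (cong (when (does (i ℕ.≟ a))) (ℤ.*-identityˡ (f (n ∸ i))))))
                   (pick (a ℕ.≤? n))
  where
  pick : (a≤?n : Dec (a ≤ n)) → sumTo (suc n) (λ i → [ i ≟ a ]· f (n ∸ i)) ≡ when (does a≤?n) (f (n ∸ a))
  pick (yes a≤n) = sumTo-[≟] (λ i → f (n ∸ i)) (s≤s a≤n)
  pick (no  a≰n) = sumTo-[≟]-out (λ i → f (n ∸ i)) (ℕ.≰⇒> a≰n)

q^-⊛-≥ : ∀ a f n → a ≤ n → (q^ a ⊛ f) n ≡ f (n ∸ a)
q^-⊛-≥ a f n a≤n = trans (q^-⊛ a f n) (cong (λ b → when b (f (n ∸ a))) (dec-true (a ℕ.≤? n) a≤n))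

q^-⊛-< : ∀ a f n → n < a → (q^ a ⊛ f) n ≡ + 0
q^-⊛-< a f n n<a = trans (q^-⊛ a f n) (cong (λ b → when b (f (n ∸ a))) (dec-false (a ℕ.≤? n) (ℕ.<⇒≱ n<a)))

q^suc-⊛-vanishes : ∀ (X : ℕ → PowerSeries) n i → n ≤ i → (q^ suc i ⊛ X i) n ≡ + 0
q^suc-⊛-vanishes X n i n≤i = q^-⊛-< (suc i) (X i) n (s≤s n≤i)

shifts-at-0 : ∀ X m → shifts X m 0 ≡ + 0
shifts-at-0 X m = sumTo-zero m (λ i _ → q^suc-⊛-vanishes X 0 i z≤n)

q^-+ : ∀ a b → q^ a ⊛ q^ b ≗ q^ (a ℕ.+ b)
q^-+ a b n with a ℕ.≤? n
... | yes a≤n = trans (q^-⊛-≥ a (q^ b) n a≤n) ([≟]-⇔ {n ∸ a} {b} (+ 1) (mk⇔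
      (λ n∸a≡b → trans (sym (ℕ.m+[n∸m]≡n a≤n)) (cong (a ℕ.+_) n∸a≡b))
      (λ n≡a+b → trans (cong (_∸ a) n≡a+b) (ℕ.m+n∸m≡n a b))))
... | no  a≰n = trans (q^-⊛-< a (q^ b) n (ℕ.≰⇒> a≰n))
      (sym ([≟]-no {n} {a ℕ.+ b} (+ 1) (λ n≡a+b → a≰n (subst (a ≤_) (sym n≡a+b) (ℕ.m≤m+n a b)))))

⊛-linearʳ : ∀ f g h a b n → (f ⊛ (λ t → a *ℤ g t - b *ℤ h t)) n ≡ a *ℤ (f ⊛ g) n - b *ℤ (f ⊛ h) n
⊛-linearʳ f g h a b n = begin
    sumTo (suc n) (λ i → f i *ℤ (a *ℤ g (n ∸ i) - b *ℤ h (n ∸ i)))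
  ≡⟨ sumTo-cong (suc n) (λ i → expand a b (f i) (g (n ∸ i)) (h (n ∸ i))) ⟩
    sumTo (suc n) (λ i → a *ℤ (f i *ℤ g (n ∸ i)) + (- b) *ℤ (f i *ℤ h (n ∸ i)))
  ≡⟨ sumTo-distrib-+ (suc n) (λ i → a *ℤ (f i *ℤ g (n ∸ i))) (λ i → (- b) *ℤ (f i *ℤ h (n ∸ i))) ⟩
    sumTo (suc n) (λ i → a *ℤ (f i *ℤ g (n ∸ i))) + sumTo (suc n) (λ i → (- b) *ℤ (f i *ℤ h (n ∸ i)))
  ≡⟨ cong₂ _+_ (sumTo-*ˡ (suc n) a (λ i → f i *ℤ g (n ∸ i))) (sumTo-*ˡ (suc n) (- b) (λ i → f i *ℤ h (n ∸ i))) ⟩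
    a *ℤ (f ⊛ g) n + (- b) *ℤ (f ⊛ h) n
  ≡⟨ cong (λ s → a *ℤ (f ⊛ g) n + s) (ℤ.neg-distribˡ-* b ((f ⊛ h) n)) ⟨
    a *ℤ (f ⊛ g) n - b *ℤ (f ⊛ h) n ∎
  where
  open ≡-Reasoning
  expand : ∀ a b x y z → x *ℤ (a *ℤ y - b *ℤ z) ≡ a *ℤ (x *ℤ y) + (- b) *ℤ (x *ℤ z)
  expand = solve-∀

open PowerSeries-solver using (Polynomial; solve; _:=_; _:+_; _:*_; :-_; _:-_; con)

module ≗-Reasoning = Relation.Binary.Reasoning.Setoid (CommutativeRing.setoid PowerSeries-commutativeRing)

-- Geometric series

geomWith : (ℕ → ℤ) → ℕ → PowerSeries
geomWith w k n = sumTo (suc n) (λ j → [ k * j ≟ n ]· w j)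

geom⁺With : (ℕ → ℤ) → ℕ → ℕ → ℤ
geom⁺With w k t = sumTo t (λ j → [ k * suc j ≟ t ]· w (suc j))

geomWith-split : ∀ w k t → geomWith w k t ≡ [ t ≟ 0 ]· w 0 + geom⁺With w k t
geomWith-split w k t = cong (_+ geom⁺With w k t)
  ([≟]-⇔ {k * 0} {t} (w 0) (mk⇔ (λ k*0≡t → trans (sym k*0≡t) (ℕ.*-zeroʳ k))
                                  (λ t≡0 → trans (ℕ.*-zeroʳ k) (sym t≡0))))

geomWith-unfold : ∀ w k .{{_ : NonZero k}} →
  geomWith w k ≗ constant (w 0) ⊕ q^ k ⊛ geomWith (λ j → w (suc j)) k
geomWith-unfold w k n = trans (geomWith-split w k n)
  (cong (λ s → constant (w 0) n + s) (trans (positive-part (k ℕ.≤? n)) (sym (q^-⊛ k (geomWith (λ j → w (suc j)) k) n))))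
  where
  w⁺ : ℕ → ℤ
  w⁺ j = w (suc j)
  positive-part : (k≤?n : Dec (k ≤ n)) → geom⁺With w k n ≡ when (does k≤?n) (geomWith w⁺ k (n ∸ k))
  positive-part (yes k≤n) = begin
      sumTo n (λ j → [ k * suc j ≟ n ]· w⁺ j)
    ≡⟨ sumTo-extend (λ j → [ k * suc j ≟ n ]· w⁺ j) (ℕ.∸-monoʳ-< (ℕ.>-nonZero⁻¹ k) k≤n)
         (λ j n∸k<j → [≟]-no {k * suc j} {n} (w⁺ j)
           (λ eq → ℕ.<-irrefl (sym (shift⇒ j eq)) (ℕ.<-≤-trans n∸k<j (ℕ.m≤n*m j k)))) ⟩
      sumTo (suc (n ∸ k)) (λ j → [ k * suc j ≟ n ]· w⁺ j)
    ≡⟨ sumTo-cong (suc (n ∸ k)) (λ j → [≟]-⇔ {k * suc j} {n} (w⁺ j) (mk⇔ (shift⇒ j) (shift⇐ j))) ⟩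
      geomWith w⁺ k (n ∸ k) ∎
    where
    open ≡-Reasoning
    shift⇒ : ∀ j → k * suc j ≡ n → k * j ≡ n ∸ k
    shift⇒ j eq = trans (sym (ℕ.m+n∸m≡n k (k * j))) (cong (_∸ k) (trans (sym (ℕ.*-suc k j)) eq))
    shift⇐ : ∀ j → k * j ≡ n ∸ k → k * suc j ≡ n
    shift⇐ j eq = trans (ℕ.*-suc k j) (trans (cong (k ℕ.+_) eq) (ℕ.m+[n∸m]≡n k≤n))
  positive-part (no k≰n) = sumTo-zero n
    (λ j _ → [≟]-no {k * suc j} {n} (w⁺ j) (λ eq → k≰n (subst (k ≤_) eq (ℕ.m≤m*n k (suc j)))))

geomWith-cong : ∀ {v w} k → (∀ j → v j ≡ w j) → geomWith v k ≗ geomWith w k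
geomWith-cong {v} k v≡w n = sumTo-cong (suc n) {λ j → [ k * j ≟ n ]· v j} (λ j → cong (when _) (v≡w j))

geomWith-+ : ∀ v w k → geomWith (λ j → v j + w j) k ≗ geomWith v k ⊕ geomWith w k
geomWith-+ v w k n = trans
  (sumTo-cong (suc n) {λ j → [ k * j ≟ n ]· (v j + w j)} (λ j → when-+ (does (k * j ℕ.≟ n)) (v j) (w j)))
  (sumTo-distrib-+ (suc n) (λ j → [ k * j ≟ n ]· v j) (λ j → [ k * j ≟ n ]· w j))

geomWith-*ˡ : ∀ c v k → geomWith (λ j → c *ℤ v j) k ≗ constant c ⊛ geomWith v k
geomWith-*ˡ c v k n = begin
    sumTo (suc n) (λ j → [ k * j ≟ n ]· (c *ℤ v j))
  ≡⟨ sumTo-cong (suc n) (λ j → when-*ʳ (does (k * j ℕ.≟ n)) c (v j)) ⟩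
    sumTo (suc n) (λ j → c *ℤ [ k * j ≟ n ]· v j)
  ≡⟨ sumTo-*ˡ (suc n) c (λ j → [ k * j ≟ n ]· v j) ⟩
    c *ℤ geomWith v k n
  ≡⟨ constant-⊛ c (geomWith v k) n ⟨
    (constant c ⊛ geomWith v k) n ∎
  where open ≡-Reasoning

geom geom₁ geom₂ : ℕ → PowerSeries
geom  = geomWith (λ _ → + 1)
geom₁ = geomWith (λ j → + j)
geom₂ = geomWith (λ j → + j *ℤ + j)

module _ (k : ℕ) .{{_ : NonZero k}} where

  private
    x : PowerSeries
    x = q^ k

  geom-rec : geom k ≗ 𝟙 ⊕ x ⊛ geom k
  geom-rec = geomWith-unfold (λ _ → + 1) k

  geom₁-rec : geom₁ k ≗ x ⊛ geom k ⊕ x ⊛ geom₁ k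
  geom₁-rec n = begin
      geom₁ k n
    ≡⟨ geomWith-unfold (λ j → + j) k n ⟩
      constant (+ 0) n + (x ⊛ geomWith (λ j → + 1 + + j) k) n
    ≡⟨ cong₂ _+_ (when-0 (does (n ℕ.≟ 0))) (⊛-cong {x} (λ _ → refl) (geomWith-+ (λ _ → + 1) (λ j → + j) k) n) ⟩
      + 0 + (x ⊛ (geom k ⊕ geom₁ k)) n
    ≡⟨ trans (ℤ.+-identityˡ _) (⊛-distribˡ-⊕ x (geom k) (geom₁ k) n) ⟩
      (x ⊛ geom k ⊕ x ⊛ geom₁ k) n ∎
    where open ≡-Reasoning

  geom₂-rec : geom₂ k ≗ x ⊛ (geom k ⊕ geom₁ k ⊕ geom₁ k) ⊕ x ⊛ geom₂ k
  geom₂-rec n = begin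
      geom₂ k n
    ≡⟨ geomWith-unfold (λ j → + j *ℤ + j) k n ⟩
      constant (+ 0) n + (x ⊛ geomWith (λ j → + suc j *ℤ + suc j) k) n
    ≡⟨ cong₂ _+_ (when-0 (does (n ℕ.≟ 0))) (⊛-cong {x} (λ _ → refl) expand n) ⟩
      + 0 + (x ⊛ ((geom k ⊕ geom₁ k ⊕ geom₁ k) ⊕ geom₂ k)) n
    ≡⟨ trans (ℤ.+-identityˡ _) (⊛-distribˡ-⊕ x (geom k ⊕ geom₁ k ⊕ geom₁ k) (geom₂ k) n) ⟩
      (x ⊛ (geom k ⊕ geom₁ k ⊕ geom₁ k) ⊕ x ⊛ geom₂ k) n ∎
    where
    open ≡-Reasoning
    square-suc : ∀ j → + suc j *ℤ + suc j ≡ + 1 + + j + + j + + j *ℤ + j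
    square-suc j = sq (+ j)
      where
      sq : ∀ a → (+ 1 + a) *ℤ (+ 1 + a) ≡ + 1 + a + a + a *ℤ a
      sq = solve-∀
    expand : geomWith (λ j → + suc j *ℤ + suc j) k ≗ (geom k ⊕ geom₁ k ⊕ geom₁ k) ⊕ geom₂ k
    expand t = begin
        geomWith (λ j → + suc j *ℤ + suc j) k t
      ≡⟨ geomWith-cong k square-suc t ⟩
        geomWith (λ j → + 1 + + j + + j + + j *ℤ + j) k t
      ≡⟨ geomWith-+ (λ j → + 1 + + j + + j) (λ j → + j *ℤ + j) k t ⟩
        geomWith (λ j → + 1 + + j + + j) k t + geom₂ k t
      ≡⟨ cong (_+ geom₂ k t) (trans (geomWith-+ (λ j → + 1 + + j) (λ j → + j) k t)
                               (cong (_+ geom₁ k t) (geomWith-+ (λ _ → + 1) (λ j → + j) k t))) ⟩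
        geom k t + geom₁ k t + geom₁ k t + geom₂ k t ∎

1-x-⊛-fixpoint : ∀ x a c → a ≗ c ⊕ x ⊛ a → (𝟙 ⊕ ⊝ x) ⊛ a ≗ c
1-x-⊛-fixpoint x a c a≗c+xa = begin
    (𝟙 ⊕ ⊝ x) ⊛ a              ≈⟨ solve 2 (λ x a → (con (+ 1) :- x) :* a := a :- x :* a) (λ _ → refl) x a ⟩
    a ⊕ ⊝ (x ⊛ a)              ≈⟨ ⊕-cong a≗c+xa (λ _ → refl) ⟩
    c ⊕ x ⊛ a ⊕ ⊝ (x ⊛ a)      ≈⟨ solve 3 (λ c x a → c :+ x :* a :- x :* a := c) (λ _ → refl) c x a ⟩
    c                          ∎
  where open ≗-Reasoning

geom-below : ∀ k .{{_ : NonZero k}} t → t < k → geom k t ≡ 𝟙 t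
geom-below k t t<k = trans (geom-rec k t) (trans (cong (λ s → 𝟙 t + s) (q^-⊛-< k (geom k) t t<k)) (ℤ.+-identityʳ (𝟙 t)))

module _ (k : ℕ) .{{_ : NonZero k}} where

  private
    x u : PowerSeries
    x = q^ k
    u = 𝟙 ⊕ ⊝ q^ k

  geom-inverse : u ⊛ geom k ≗ 𝟙
  geom-inverse = 1-x-⊛-fixpoint x (geom k) 𝟙 (geom-rec k)

  geom₁-shift : u ⊛ geom₁ k ≗ x ⊛ geom k
  geom₁-shift = 1-x-⊛-fixpoint x (geom₁ k) (x ⊛ geom k) (geom₁-rec k)

  geom₂-shift : u ⊛ geom₂ k ≗ x ⊛ (geom k ⊕ geom₁ k ⊕ geom₁ k)
  geom₂-shift = 1-x-⊛-fixpoint x (geom₂ k) (x ⊛ (geom k ⊕ geom₁ k ⊕ geom₁ k)) (geom₂-rec k)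

  geom-variance : u ⊛ u ⊛ (geom k ⊛ geom₂ k ⊕ ⊝ (geom₁ k ⊛ geom₁ k)) ≗ geom₁ k
  geom-variance = begin
      u ⊛ u ⊛ (G ⊛ G₂ ⊕ ⊝ (G₁ ⊛ G₁))
    ≈⟨ solve 4 (λ x g g₁ g₂ → (con (+ 1) :- x) :* (con (+ 1) :- x) :* (g :* g₂ :- g₁ :* g₁)
                 := ((con (+ 1) :- x) :* g) :* ((con (+ 1) :- x) :* g₂)
                    :- ((con (+ 1) :- x) :* g₁) :* ((con (+ 1) :- x) :* g₁)) (λ _ → refl) x G G₁ G₂ ⟩
      (u ⊛ G) ⊛ (u ⊛ G₂) ⊕ ⊝ ((u ⊛ G₁) ⊛ (u ⊛ G₁))
    ≈⟨ ⊕-cong (⊛-cong geom-inverse geom₂-shift) (⊝-cong (⊛-cong {u ⊛ G₁} geom₁-shift (λ _ → refl))) ⟩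
      𝟙 ⊛ (x ⊛ (G ⊕ G₁ ⊕ G₁)) ⊕ ⊝ ((x ⊛ G) ⊛ (u ⊛ G₁))
    ≈⟨ solve 4 (λ x g g₁ o → o :* (x :* (g :+ g₁ :+ g₁)) :- (x :* g) :* ((con (+ 1) :- x) :* g₁)
                 := o :* (x :* (g :+ g₁ :+ g₁)) :- (x :* g₁) :* ((con (+ 1) :- x) :* g)) (λ _ → refl) x G G₁ 𝟙 ⟩
      𝟙 ⊛ (x ⊛ (G ⊕ G₁ ⊕ G₁)) ⊕ ⊝ ((x ⊛ G₁) ⊛ (u ⊛ G))
    ≈⟨ ⊕-cong {𝟙 ⊛ (x ⊛ (G ⊕ G₁ ⊕ G₁))} (λ _ → refl) (⊝-cong (⊛-cong {x ⊛ G₁} (λ _ → refl) geom-inverse)) ⟩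
      𝟙 ⊛ (x ⊛ (G ⊕ G₁ ⊕ G₁)) ⊕ ⊝ ((x ⊛ G₁) ⊛ 𝟙)
    ≈⟨ solve 3 (λ x g g₁ → con (+ 1) :* (x :* (g :+ g₁ :+ g₁)) :- (x :* g₁) :* con (+ 1)
                 := x :* g :+ x :* g₁) (λ _ → refl) x G G₁ ⟩
      x ⊛ G ⊕ x ⊛ G₁
    ≈⟨ geom₁-rec k ⟨
      G₁ ∎
    where
    open ≗-Reasoning
    G G₁ G₂ : PowerSeries
    G  = geom k
    G₁ = geom₁ k
    G₂ = geom₂ k

1-q^-cancel : ∀ k .{{_ : NonZero k}} a b → (𝟙 ⊕ ⊝ q^ k) ⊛ a ≗ (𝟙 ⊕ ⊝ q^ k) ⊛ b → a ≗ b
1-q^-cancel k a b ua≗ub = begin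
    a                          ≈⟨ solve 1 (λ a → a := con (+ 1) :* a) (λ _ → refl) a ⟩
    𝟙 ⊛ a                      ≈⟨ ⊛-cong (geom-inverse k) (λ _ → refl) ⟨
    (u ⊛ geom k) ⊛ a           ≈⟨ solve 3 (λ u g a → (u :* g) :* a := g :* (u :* a)) (λ _ → refl) u (geom k) a ⟩
    geom k ⊛ (u ⊛ a)           ≈⟨ ⊛-cong {geom k} (λ _ → refl) ua≗ub ⟩
    geom k ⊛ (u ⊛ b)           ≈⟨ solve 3 (λ u g b → g :* (u :* b) := (u :* g) :* b) (λ _ → refl) u (geom k) b ⟩
    (u ⊛ geom k) ⊛ b           ≈⟨ ⊛-cong (geom-inverse k) (λ _ → refl) ⟩
    𝟙 ⊛ b                      ≈⟨ solve 1 (λ b → con (+ 1) :* b := b) (λ _ → refl) b ⟩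
    b                          ∎
  where
  open ≗-Reasoning
  u : PowerSeries
  u = 𝟙 ⊕ ⊝ q^ k

-- q^m/(1+q^m) = q^m/(1−q^m) − 2q^{2m}/(1−q^{2m})
altGeom : ℕ → PowerSeries
altGeom m = (geom m ⊕ ⊝ 𝟙) ⊕ ⊝ (constant (+ 2) ⊛ (geom (2 * m) ⊕ ⊝ 𝟙))

altGeom-spec : ∀ m .{{_ : NonZero m}} → (𝟙 ⊕ q^ m) ⊛ altGeom m ≗ q^ m
altGeom-spec m = 1-q^-cancel m ((𝟙 ⊕ x) ⊛ altGeom m) x (begin
    (𝟙 ⊕ ⊝ x) ⊛ ((𝟙 ⊕ x) ⊛ altGeom m)
  ≈⟨ solve 3 (λ x g h → (con (+ 1) :- x) :* ((con (+ 1) :+ x) :* ((g :- con (+ 1)) :- con (+ 2) :* (h :- con (+ 1))))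
                := (con (+ 1) :+ x) :* ((con (+ 1) :- x) :* g) :- (con (+ 1) :+ x) :* (con (+ 1) :- x)
                   :- con (+ 2) :* ((con (+ 1) :- x :* x) :* h :- (con (+ 1) :- x :* x)))
           (λ _ → refl) x g h ⟩
    (𝟙 ⊕ x) ⊛ ((𝟙 ⊕ ⊝ x) ⊛ g) ⊕ ⊝ ((𝟙 ⊕ x) ⊛ (𝟙 ⊕ ⊝ x))
      ⊕ ⊝ (constant (+ 2) ⊛ ((𝟙 ⊕ ⊝ (x ⊛ x)) ⊛ h ⊕ ⊝ (𝟙 ⊕ ⊝ (x ⊛ x))))
  ≈⟨ ⊕-cong (⊕-cong (⊛-cong {𝟙 ⊕ x} (λ _ → refl) (geom-inverse m)) (λ _ → refl))
            (⊝-cong (⊛-cong {constant (+ 2)} (λ _ → refl) (⊕-cong (⊛-cong 1-x²≗1-q^2m (λ _ → refl)) (λ _ → refl)))) ⟩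
    (𝟙 ⊕ x) ⊛ 𝟙 ⊕ ⊝ ((𝟙 ⊕ x) ⊛ (𝟙 ⊕ ⊝ x))
      ⊕ ⊝ (constant (+ 2) ⊛ ((𝟙 ⊕ ⊝ q^ (2 * m)) ⊛ h ⊕ ⊝ (𝟙 ⊕ ⊝ (x ⊛ x))))
  ≈⟨ ⊕-cong {(𝟙 ⊕ x) ⊛ 𝟙 ⊕ ⊝ ((𝟙 ⊕ x) ⊛ (𝟙 ⊕ ⊝ x))} (λ _ → refl)
            (⊝-cong (⊛-cong {constant (+ 2)} (λ _ → refl) (⊕-cong (geom-inverse (2 * m) {{ℕ.m*n≢0 2 m}}) (λ _ → refl)))) ⟩
    (𝟙 ⊕ x) ⊛ 𝟙 ⊕ ⊝ ((𝟙 ⊕ x) ⊛ (𝟙 ⊕ ⊝ x)) ⊕ ⊝ (constant (+ 2) ⊛ (𝟙 ⊕ ⊝ (𝟙 ⊕ ⊝ (x ⊛ x))))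
  ≈⟨ solve 1 (λ x → (con (+ 1) :+ x) :* con (+ 1) :- (con (+ 1) :+ x) :* (con (+ 1) :- x)
                    :- con (+ 2) :* (con (+ 1) :- (con (+ 1) :- x :* x))
                := (con (+ 1) :- x) :* x) (λ _ → refl) x ⟩
    (𝟙 ⊕ ⊝ x) ⊛ x ∎)
  where
  open ≗-Reasoning
  x g h : PowerSeries
  x = q^ m
  g = geom m
  h = geom (2 * m)
  1-x²≗1-q^2m : 𝟙 ⊕ ⊝ (x ⊛ x) ≗ 𝟙 ⊕ ⊝ q^ (2 * m)
  1-x²≗1-q^2m n = cong (λ s → 𝟙 n + - s)
    (trans (q^-+ m m n) (cong (λ e → (q^ (m ℕ.+ e)) n) (sym (ℕ.+-identityʳ m))))

geom⁺With-extend : ∀ w k .{{_ : NonZero k}} {t n} → t ≤ n →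
  geom⁺With w k t ≡ sumTo n (λ j → [ k * suc j ≟ t ]· w (suc j))
geom⁺With-extend w k {t} t≤n = sym (sumTo-extend (λ j → [ k * suc j ≟ t ]· w (suc j)) t≤n
  (λ j t≤j → [≟]-no {k * suc j} {t} (w (suc j)) (λ eq → ℕ.<-irrefl (sym eq) (ℕ.<-≤-trans (s≤s t≤j) (ℕ.m≤n*m (suc j) k)))))

geom⁺-vanishes : ∀ m t → t < m → geom⁺With (λ _ → + 1) m t ≡ + 0
geom⁺-vanishes m t t<m = sumTo-zero t (λ j _ → [≟]-no {m * suc j} {t} (+ 1)
  (λ eq → ℕ.<-irrefl (sym eq) (ℕ.<-≤-trans t<m (ℕ.m≤m*n m (suc j)))))

geom₁-coeff : ∀ y t → geom₁ y t ≡ geom⁺With +_ y t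
geom₁-coeff y t = trans (geomWith-split +_ y t)
  (trans (cong (_+ geom⁺With +_ y t) (when-0 (does (t ℕ.≟ 0)))) (ℤ.+-identityˡ _))

altGeom-coeff : ∀ m t → altGeom m t ≡ geom⁺With (λ _ → + 1) m t - + 2 *ℤ geom⁺With (λ _ → + 1) (2 * m) t
altGeom-coeff m t = begin
    geom m t + - 𝟙 t + - (constant (+ 2) ⊛ (geom (2 * m) ⊕ ⊝ 𝟙)) t
  ≡⟨ cong (λ s → geom m t + - 𝟙 t + - s) (constant-⊛ (+ 2) (geom (2 * m) ⊕ ⊝ 𝟙) t) ⟩
    geom m t + - 𝟙 t + - (+ 2 *ℤ (geom (2 * m) t + - 𝟙 t))
  ≡⟨ cong₂ (λ u v → u + - 𝟙 t + - (+ 2 *ℤ (v + - 𝟙 t)))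
           (geomWith-split (λ _ → + 1) m t) (geomWith-split (λ _ → + 1) (2 * m) t) ⟩
    𝟙 t + G m + - 𝟙 t + - (+ 2 *ℤ (𝟙 t + G (2 * m) + - 𝟙 t))
  ≡⟨ cancel (𝟙 t) (G m) (G (2 * m)) ⟩
    G m - + 2 *ℤ G (2 * m) ∎
  where
  open ≡-Reasoning
  G : ℕ → ℤ
  G k = geom⁺With (λ _ → + 1) k t
  cancel : ∀ o a b → o + a + - o + - (+ 2 *ℤ (o + b + - o)) ≡ a - + 2 *ℤ b
  cancel = solve-∀

-- The second z-moment of C̄[r]

moment : (ℤ → ℤ) → Laurent → ℤ
moment w xs = ∑ₗ xs (λ m → w (proj₁ m) *ℤ proj₂ m)

-- μ₂ is δ²at1 on the nose.
μ₀ μ₁ μ₂ : Laurent → ℤ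
μ₀ = moment (λ _ → + 1)
μ₁ = moment (λ e → e)
μ₂ = moment (λ e → e *ℤ e)

monomial-* : ℤ × ℤ → Laurent → Laurent
monomial-* x = map (λ y → (proj₁ x + proj₁ y , proj₂ x *ℤ proj₂ y))

module _ (x : ℤ × ℤ) (ys : Laurent) where

  private
    a c : ℤ
    a = proj₁ x
    c = proj₂ x
    moment-monomial-* : ∀ w → moment w (monomial-* x ys) ≡ ∑ₗ ys (λ y → w (a + proj₁ y) *ℤ (c *ℤ proj₂ y))
    moment-monomial-* w = ∑ₗ-map (λ y → (a + proj₁ y , c *ℤ proj₂ y)) ys (λ m → w (proj₁ m) *ℤ proj₂ m)

  μ₀-monomial-* : μ₀ (monomial-* x ys) ≡ c *ℤ μ₀ ys
  μ₀-monomial-* = trans (moment-monomial-* (λ _ → + 1))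
    (trans (∑ₗ-cong ys (λ y → expand c (proj₂ y))) (∑ₗ-*ˡ ys c (λ y → + 1 *ℤ proj₂ y)))
    where
    expand : ∀ c d → + 1 *ℤ (c *ℤ d) ≡ c *ℤ (+ 1 *ℤ d)
    expand = solve-∀

  μ₁-monomial-* : μ₁ (monomial-* x ys) ≡ a *ℤ c *ℤ μ₀ ys + c *ℤ μ₁ ys
  μ₁-monomial-* = trans (moment-monomial-* (λ e → e))
    (trans (∑ₗ-cong ys (λ y → expand a c (proj₁ y) (proj₂ y)))
           (∑ₗ-linear₂ ys (a *ℤ c) c (λ y → + 1 *ℤ proj₂ y) (λ y → proj₁ y *ℤ proj₂ y)))
    where
    expand : ∀ a c e d → (a + e) *ℤ (c *ℤ d) ≡ a *ℤ c *ℤ (+ 1 *ℤ d) + c *ℤ (e *ℤ d)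
    expand = solve-∀

  μ₂-monomial-* : μ₂ (monomial-* x ys) ≡ a *ℤ a *ℤ c *ℤ μ₀ ys + (a *ℤ c *ℤ μ₁ ys + a *ℤ c *ℤ μ₁ ys) + c *ℤ μ₂ ys
  μ₂-monomial-* = trans (moment-monomial-* (λ e → e *ℤ e))
    (trans (∑ₗ-cong ys (λ y → expand a c (proj₁ y) (proj₂ y)))
    (trans (∑ₗ-linear₃ ys (a *ℤ a *ℤ c) (+ 2 *ℤ (a *ℤ c)) c
                       (λ y → + 1 *ℤ proj₂ y) (λ y → proj₁ y *ℤ proj₂ y) (λ y → proj₁ y *ℤ proj₁ y *ℤ proj₂ y))
           (double (a *ℤ a *ℤ c) (a *ℤ c) c (μ₀ ys) (μ₁ ys) (μ₂ ys))))
    where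
    expand : ∀ a c e d → (a + e) *ℤ (a + e) *ℤ (c *ℤ d)
                         ≡ a *ℤ a *ℤ c *ℤ (+ 1 *ℤ d) + + 2 *ℤ (a *ℤ c) *ℤ (e *ℤ d) + c *ℤ (e *ℤ e *ℤ d)
    expand = solve-∀
    double : ∀ p q r u v w → p *ℤ u + + 2 *ℤ q *ℤ v + r *ℤ w ≡ p *ℤ u + (q *ℤ v + q *ℤ v) + r *ℤ w
    double = solve-∀

module _ (xs ys : Laurent) where

  private
    moment-mulL : ∀ w → moment w (mulL xs ys) ≡ ∑ₗ xs (λ x → moment w (monomial-* x ys))
    moment-mulL w = ∑ₗ-concatMap (λ x → monomial-* x ys) xs (λ m → w (proj₁ m) *ℤ proj₂ m)
    c₀ c₁ c₂ : ℤ × ℤ → ℤ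
    c₀ x = + 1 *ℤ proj₂ x
    c₁ x = proj₁ x *ℤ proj₂ x
    c₂ x = proj₁ x *ℤ proj₁ x *ℤ proj₂ x

  μ₀-mulL : μ₀ (mulL xs ys) ≡ μ₀ xs *ℤ μ₀ ys
  μ₀-mulL = begin
      μ₀ (mulL xs ys)
    ≡⟨ moment-mulL (λ _ → + 1) ⟩
      ∑ₗ xs (λ x → μ₀ (monomial-* x ys))
    ≡⟨ ∑ₗ-cong xs (λ x → trans (μ₀-monomial-* x ys) (regroup (proj₂ x) (μ₀ ys))) ⟩
      ∑ₗ xs (λ x → μ₀ ys *ℤ c₀ x)
    ≡⟨ ∑ₗ-*ˡ xs (μ₀ ys) c₀ ⟩
      μ₀ ys *ℤ μ₀ xs
    ≡⟨ ℤ.*-comm (μ₀ ys) (μ₀ xs) ⟩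
      μ₀ xs *ℤ μ₀ ys ∎
    where
    open ≡-Reasoning
    regroup : ∀ c u → c *ℤ u ≡ u *ℤ (+ 1 *ℤ c)
    regroup = solve-∀

  μ₁-mulL : μ₁ (mulL xs ys) ≡ μ₁ xs *ℤ μ₀ ys + μ₀ xs *ℤ μ₁ ys
  μ₁-mulL = begin
      μ₁ (mulL xs ys)
    ≡⟨ moment-mulL (λ e → e) ⟩
      ∑ₗ xs (λ x → μ₁ (monomial-* x ys))
    ≡⟨ ∑ₗ-cong xs (λ x → trans (μ₁-monomial-* x ys) (regroup (proj₁ x) (proj₂ x) (μ₀ ys) (μ₁ ys))) ⟩
      ∑ₗ xs (λ x → μ₀ ys *ℤ c₁ x + μ₁ ys *ℤ c₀ x)
    ≡⟨ ∑ₗ-linear₂ xs (μ₀ ys) (μ₁ ys) c₁ c₀ ⟩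
      μ₀ ys *ℤ μ₁ xs + μ₁ ys *ℤ μ₀ xs
    ≡⟨ commute (μ₀ ys) (μ₁ xs) (μ₁ ys) (μ₀ xs) ⟩
      μ₁ xs *ℤ μ₀ ys + μ₀ xs *ℤ μ₁ ys ∎
    where
    open ≡-Reasoning
    regroup : ∀ a c u v → a *ℤ c *ℤ u + c *ℤ v ≡ u *ℤ (a *ℤ c) + v *ℤ (+ 1 *ℤ c)
    regroup = solve-∀
    commute : ∀ u p v q → u *ℤ p + v *ℤ q ≡ p *ℤ u + q *ℤ v
    commute = solve-∀

  μ₂-mulL : μ₂ (mulL xs ys) ≡ μ₂ xs *ℤ μ₀ ys + (μ₁ xs *ℤ μ₁ ys + μ₁ xs *ℤ μ₁ ys) + μ₀ xs *ℤ μ₂ ys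
  μ₂-mulL = begin
      μ₂ (mulL xs ys)
    ≡⟨ moment-mulL (λ e → e *ℤ e) ⟩
      ∑ₗ xs (λ x → μ₂ (monomial-* x ys))
    ≡⟨ ∑ₗ-cong xs (λ x → trans (μ₂-monomial-* x ys) (regroup (proj₁ x) (proj₂ x) (μ₀ ys) (μ₁ ys) (μ₂ ys))) ⟩
      ∑ₗ xs (λ x → μ₀ ys *ℤ c₂ x + + 2 *ℤ μ₁ ys *ℤ c₁ x + μ₂ ys *ℤ c₀ x)
    ≡⟨ ∑ₗ-linear₃ xs (μ₀ ys) (+ 2 *ℤ μ₁ ys) (μ₂ ys) c₂ c₁ c₀ ⟩
      μ₀ ys *ℤ μ₂ xs + + 2 *ℤ μ₁ ys *ℤ μ₁ xs + μ₂ ys *ℤ μ₀ xs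
    ≡⟨ commute (μ₀ ys) (μ₂ xs) (μ₁ ys) (μ₁ xs) (μ₂ ys) (μ₀ xs) ⟩
      μ₂ xs *ℤ μ₀ ys + (μ₁ xs *ℤ μ₁ ys + μ₁ xs *ℤ μ₁ ys) + μ₀ xs *ℤ μ₂ ys ∎
    where
    open ≡-Reasoning
    regroup : ∀ a c u v w → a *ℤ a *ℤ c *ℤ u + (a *ℤ c *ℤ v + a *ℤ c *ℤ v) + c *ℤ w
                            ≡ u *ℤ (a *ℤ a *ℤ c) + + 2 *ℤ v *ℤ (a *ℤ c) + w *ℤ (+ 1 *ℤ c)
    regroup = solve-∀
    commute : ∀ u p v q w r → u *ℤ p + + 2 *ℤ v *ℤ q + w *ℤ r ≡ p *ℤ u + (q *ℤ v + q *ℤ v) + r *ℤ w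
    commute = solve-∀

E₀ E₁ E₂ : Series → PowerSeries
E₀ f n = μ₀ (f n)
E₁ f n = μ₁ (f n)
E₂ f n = μ₂ (f n)

-- For C = Σₙ f(n) qⁿ with Laurent coefficients in z, jet f records C, δ_z C and δ_z² C at z = 1;
-- _⊗_ is the Leibniz rule for δ_z.
record Jet : Set where
  constructor ⟨_,_,_⟩
  field
    j₀ j₁ j₂ : PowerSeries

open Jet

jet : Series → Jet
jet f = ⟨ E₀ f , E₁ f , E₂ f ⟩

infixl 7 _⊗_
_⊗_ : Jet → Jet → Jet
⟨ a₀ , a₁ , a₂ ⟩ ⊗ ⟨ b₀ , b₁ , b₂ ⟩ =
  ⟨ a₀ ⊛ b₀ , a₁ ⊛ b₀ ⊕ a₀ ⊛ b₁ , a₂ ⊛ b₀ ⊕ (a₁ ⊛ b₁ ⊕ a₁ ⊛ b₁) ⊕ a₀ ⊛ b₂ ⟩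

infix 4 _≈ʲ_
_≈ʲ_ : Jet → Jet → Set
J ≈ʲ K = j₀ J ≗ j₀ K × j₁ J ≗ j₁ K × j₂ J ≗ j₂ K

≈ʲ-trans : ∀ {J K L} → J ≈ʲ K → K ≈ʲ L → J ≈ʲ L
≈ʲ-trans (p₀ , p₁ , p₂) (q₀ , q₁ , q₂) =
  (λ n → trans (p₀ n) (q₀ n)) , (λ n → trans (p₁ n) (q₁ n)) , (λ n → trans (p₂ n) (q₂ n))

⊗-cong : ∀ {J J′ K K′} → J ≈ʲ J′ → K ≈ʲ K′ → J ⊗ K ≈ʲ J′ ⊗ K′
⊗-cong {⟨ _ , _ , _ ⟩} {⟨ _ , _ , _ ⟩} {⟨ _ , _ , _ ⟩} {⟨ _ , _ , _ ⟩} (p₀ , p₁ , p₂) (q₀ , q₁ , q₂) =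
    ⊛-cong p₀ q₀
  , ⊕-cong (⊛-cong p₁ q₀) (⊛-cong p₀ q₁)
  , ⊕-cong (⊕-cong (⊛-cong p₂ q₀) (⊕-cong (⊛-cong p₁ q₁) (⊛-cong p₁ q₁))) (⊛-cong p₀ q₂)

infixl 6 _⊞_
_⊞_ : Jet → Jet → Jet
⟨ a₀ , a₁ , a₂ ⟩ ⊞ ⟨ b₀ , b₁ , b₂ ⟩ = ⟨ a₀ ⊕ b₀ , a₁ ⊕ b₁ , a₂ ⊕ b₂ ⟩

⊞-cong : ∀ {J J′ K K′} → J ≈ʲ J′ → K ≈ʲ K′ → J ⊞ K ≈ʲ J′ ⊞ K′
⊞-cong {⟨ _ , _ , _ ⟩} {⟨ _ , _ , _ ⟩} {⟨ _ , _ , _ ⟩} {⟨ _ , _ , _ ⟩} (p₀ , p₁ , p₂) (q₀ , q₁ , q₂) =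
  ⊕-cong p₀ q₀ , ⊕-cong p₁ q₁ , ⊕-cong p₂ q₂

infixr 7 _·ʲ_
_·ʲ_ : PowerSeries → Jet → Jet
a ·ʲ ⟨ b₀ , b₁ , b₂ ⟩ = ⟨ a ⊛ b₀ , a ⊛ b₁ , a ⊛ b₂ ⟩

scalar-⊗ : ∀ a J → ⟨ a , 𝟘 , 𝟘 ⟩ ⊗ J ≈ʲ a ·ʲ J
scalar-⊗ a ⟨ b₀ , b₁ , b₂ ⟩ =
    (λ _ → refl)
  , solve 3 (λ a b₀ b₁ → con (+ 0) :* b₀ :+ a :* b₁ := a :* b₁) (λ _ → refl) a b₀ b₁
  , solve 4 (λ a b₀ b₁ b₂ → con (+ 0) :* b₀ :+ (con (+ 0) :* b₁ :+ con (+ 0) :* b₁) :+ a :* b₂ := a :* b₂)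
            (λ _ → refl) a b₀ b₁ b₂

module _ (f g : Series) (n : ℕ) where

  private
    moment-mulS : ∀ w → moment w (mulS f g n) ≡ sumTo (suc n) (λ i → moment w (mulL (f i) (g (n ∸ i))))
    moment-mulS w = trans (∑ₗ-concatMap (λ i → mulL (f i) (g (n ∸ i))) (upTo (suc n)) (λ m → w (proj₁ m) *ℤ proj₂ m))
                          (∑ₗ-applyUpTo (suc n) (λ i → i) (λ i → moment w (mulL (f i) (g (n ∸ i)))))

  E₀-mulS : E₀ (mulS f g) n ≡ (E₀ f ⊛ E₀ g) n
  E₀-mulS = trans (moment-mulS (λ _ → + 1)) (sumTo-cong (suc n) (λ i → μ₀-mulL (f i) (g (n ∸ i))))

  E₁-mulS : E₁ (mulS f g) n ≡ (E₁ f ⊛ E₀ g ⊕ E₀ f ⊛ E₁ g) n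
  E₁-mulS = begin
      E₁ (mulS f g) n
    ≡⟨ moment-mulS (λ e → e) ⟩
      sumTo (suc n) (λ i → μ₁ (mulL (f i) (g (n ∸ i))))
    ≡⟨ sumTo-cong (suc n) (λ i → μ₁-mulL (f i) (g (n ∸ i))) ⟩
      sumTo (suc n) (λ i → E₁ f i *ℤ E₀ g (n ∸ i) + E₀ f i *ℤ E₁ g (n ∸ i))
    ≡⟨ sumTo-distrib-+ (suc n) (λ i → E₁ f i *ℤ E₀ g (n ∸ i)) (λ i → E₀ f i *ℤ E₁ g (n ∸ i)) ⟩
      (E₁ f ⊛ E₀ g ⊕ E₀ f ⊛ E₁ g) n ∎
    where open ≡-Reasoning

  E₂-mulS : E₂ (mulS f g) n ≡ (E₂ f ⊛ E₀ g ⊕ (E₁ f ⊛ E₁ g ⊕ E₁ f ⊛ E₁ g) ⊕ E₀ f ⊛ E₂ g) n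
  E₂-mulS = begin
      E₂ (mulS f g) n
    ≡⟨ moment-mulS (λ e → e *ℤ e) ⟩
      sumTo (suc n) (λ i → μ₂ (mulL (f i) (g (n ∸ i))))
    ≡⟨ sumTo-cong (suc n) (λ i → μ₂-mulL (f i) (g (n ∸ i))) ⟩
      sumTo (suc n) (λ i → a i + (b i + b i) + c i)
    ≡⟨ sumTo-distrib-+ (suc n) (λ i → a i + (b i + b i)) c ⟩
      sumTo (suc n) (λ i → a i + (b i + b i)) + sumTo (suc n) c
    ≡⟨ cong (_+ sumTo (suc n) c) (trans (sumTo-distrib-+ (suc n) a (λ i → b i + b i))
                                        (cong (λ s → sumTo (suc n) a + s) (sumTo-distrib-+ (suc n) b b))) ⟩
      (E₂ f ⊛ E₀ g ⊕ (E₁ f ⊛ E₁ g ⊕ E₁ f ⊛ E₁ g) ⊕ E₀ f ⊛ E₂ g) n ∎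
    where
    open ≡-Reasoning
    a b c : ℕ → ℤ
    a i = E₂ f i *ℤ E₀ g (n ∸ i)
    b i = E₁ f i *ℤ E₁ g (n ∸ i)
    c i = E₀ f i *ℤ E₂ g (n ∸ i)

jet-mulS : ∀ f g → jet (mulS f g) ≈ʲ jet f ⊗ jet g
jet-mulS f g = E₀-mulS f g , E₁-mulS f g , E₂-mulS f g

jet-mulS-≈ : ∀ f g {J K} → jet f ≈ʲ J → jet g ≈ʲ K → jet (mulS f g) ≈ʲ J ⊗ K
jet-mulS-≈ f g f≈J g≈K = ≈ʲ-trans (jet-mulS f g) (⊗-cong f≈J g≈K)

jet-scalar-mulS : ∀ f g {a K} → jet f ≈ʲ ⟨ a , 𝟘 , 𝟘 ⟩ → jet g ≈ʲ K → jet (mulS f g) ≈ʲ a ·ʲ K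
jet-scalar-mulS f g {a} {K} f≈a g≈K = ≈ʲ-trans (jet-mulS-≈ f g f≈a g≈K) (scalar-⊗ a K)

jet-addS : ∀ f g → jet (addS f g) ≈ʲ jet f ⊞ jet g
jet-addS f g = (λ n → moment-++ (λ _ → + 1) (f n) (g n)) , (λ n → moment-++ (λ e → e) (f n) (g n))
             , (λ n → moment-++ (λ e → e *ℤ e) (f n) (g n))
  where
  moment-++ : ∀ w xs ys → moment w (xs ++ ys) ≡ moment w xs + moment w ys
  moment-++ w xs ys = ∑ₗ-++ xs ys (λ m → w (proj₁ m) *ℤ proj₂ m)

jet-oneS : jet oneS ≈ʲ ⟨ 𝟙 , 𝟘 , 𝟘 ⟩
jet-oneS = (λ { zero → refl ; (suc _) → refl }) , (λ { zero → refl ; (suc _) → refl })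
         , (λ { zero → refl ; (suc _) → refl })

moment-if : ∀ w b (m : ℤ × ℤ) → moment w (if b then m ∷ [] else []) ≡ when b (w (proj₁ m) *ℤ proj₂ m + + 0)
moment-if w true  m = refl
moment-if w false m = refl

jet-monoS : ∀ c k → jet (monoS (+ 0) c k) ≈ʲ ⟨ constant c ⊛ q^ k , 𝟘 , 𝟘 ⟩
jet-monoS c k = (λ n → trans (moment-if (λ _ → + 1) ⌊ n ℕ.≟ k ⌋ (+ 0 , c))
                      (trans (cong (λ b → when b (+ 1 *ℤ c + + 0)) (isYes≗does (n ℕ.≟ k)))
                      (trans (scale (does (n ℕ.≟ k))) (sym (constant-⊛ c (q^ k) n)))))
              , (λ n → trans (moment-if (λ e → e) ⌊ n ℕ.≟ k ⌋ (+ 0 , c)) (trans (when-0 ⌊ n ℕ.≟ k ⌋) (sym (𝟘-at n))))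
              , (λ n → trans (moment-if (λ e → e *ℤ e) ⌊ n ℕ.≟ k ⌋ (+ 0 , c)) (trans (when-0 ⌊ n ℕ.≟ k ⌋) (sym (𝟘-at n))))
  where
  scale : ∀ b → when b (+ 1 *ℤ c + + 0) ≡ c *ℤ when b (+ 1)
  scale true  = trans (ℤ.+-identityʳ (+ 1 *ℤ c)) (trans (ℤ.*-identityˡ c) (sym (ℤ.*-identityʳ c)))
  scale false = sym (ℤ.*-zeroʳ c)

moment-geomS : ∀ w e k n → moment w (geomS e k n) ≡ geomWith (λ j → w (e *ℤ + j) *ℤ + 1 + + 0) k n
moment-geomS w e k n = begin
    moment w (geomS e k n)
  ≡⟨ ∑ₗ-concatMap term (upTo (suc n)) (λ m → w (proj₁ m) *ℤ proj₂ m) ⟩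
    ∑ₗ (upTo (suc n)) (λ j → moment w (term j))
  ≡⟨ ∑ₗ-applyUpTo (suc n) (λ j → j) (λ j → moment w (term j)) ⟩
    sumTo (suc n) (λ j → moment w (term j))
  ≡⟨ sumTo-cong (suc n) (λ j → trans (moment-if w ⌊ k * j ℕ.≟ n ⌋ (e *ℤ + j , + 1))
                                      (cong (λ b → when b (w (e *ℤ + j) *ℤ + 1 + + 0)) (isYes≗does (k * j ℕ.≟ n)))) ⟩
    geomWith (λ j → w (e *ℤ + j) *ℤ + 1 + + 0) k n ∎
  where
  open ≡-Reasoning
  term : ℕ → Laurent
  term j = if ⌊ k * j ℕ.≟ n ⌋ then (e *ℤ + j , + 1) ∷ [] else []

jet-geomS : ∀ e k → jet (geomS e k) ≈ʲ ⟨ geom k , constant e ⊛ geom₁ k , constant (e *ℤ e) ⊛ geom₂ k ⟩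
jet-geomS e k = moment-geomS (λ _ → + 1) e k
  , (λ n → trans (moment-geomS (λ e → e) e k n)
                 (trans (geomWith-cong k (λ j → linear e (+ j)) n) (geomWith-*ˡ e (λ j → + j) k n)))
  , (λ n → trans (moment-geomS (λ e → e *ℤ e) e k n)
                 (trans (geomWith-cong k (λ j → quadratic e (+ j)) n) (geomWith-*ˡ (e *ℤ e) (λ j → + j *ℤ + j) k n)))
  where
  linear : ∀ e j → e *ℤ j *ℤ + 1 + + 0 ≡ e *ℤ j
  linear = solve-∀
  quadratic : ∀ e j → e *ℤ j *ℤ (e *ℤ j) *ℤ + 1 + + 0 ≡ e *ℤ e *ℤ (j *ℤ j)
  quadratic = solve-∀

jet-binomial : ∀ c k → jet (addS oneS (monoS (+ 0) c k)) ≈ʲ ⟨ 𝟙 ⊕ constant c ⊛ q^ k , 𝟘 , 𝟘 ⟩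
jet-binomial c k = ≈ʲ-trans (jet-addS oneS (monoS (+ 0) c k)) (≈ʲ-trans (⊞-cong jet-oneS (jet-monoS c k))
  ((λ _ → refl) , 𝟘+𝟘 , 𝟘+𝟘))
  where
  𝟘+𝟘 : 𝟘 ⊕ 𝟘 ≗ 𝟘
  𝟘+𝟘 n = trans (cong₂ _+_ (𝟘-at n) (𝟘-at n)) (sym (𝟘-at n))

jet-geomS₀ : ∀ k → jet (geomS (+ 0) k) ≈ʲ ⟨ geom k , 𝟘 , 𝟘 ⟩
jet-geomS₀ k = ≈ʲ-trans (jet-geomS (+ 0) k)
  ( (λ _ → refl)
  , solve 1 (λ g → con (+ 0) :* g := con (+ 0)) (λ _ → refl) (geom₁ k)
  , solve 1 (λ g → con (+ 0) :* g := con (+ 0)) (λ _ → refl) (geom₂ k) )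

zDependentFactors : ℕ → Series → Series
zDependentFactors y R = mulS F₋ (mulS F₋ (mulS (geomS (+ 1) y) (mulS (geomS (- + 1) y) R)))
  where
  F₋ : Series
  F₋ = addS oneS (monoS (+ 0) (- + 1) y)

-- The z ↔ 1/z symmetry of the block cancels its first moment; geom-variance evaluates its second.
jet-zDependentFactors : ∀ y .{{_ : NonZero y}} R R₀ R₂ → jet R ≈ʲ ⟨ R₀ , 𝟘 , R₂ ⟩ →
  jet (zDependentFactors y R) ≈ʲ ⟨ R₀ , 𝟘 , R₂ ⊕ (geom₁ y ⊛ R₀ ⊕ geom₁ y ⊛ R₀) ⟩
jet-zDependentFactors y R R₀ R₂ R≈ = ≈ʲ-trans
  (jet-scalar-mulS F₋ (mulS F₋ (mulS (geomS (+ 1) y) (mulS (geomS (- + 1) y) R))) (jet-binomial (- + 1) y)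
    (jet-scalar-mulS F₋ (mulS (geomS (+ 1) y) (mulS (geomS (- + 1) y) R)) (jet-binomial (- + 1) y)
      (jet-mulS-≈ (geomS (+ 1) y) (mulS (geomS (- + 1) y) R) (jet-geomS (+ 1) y)
        (jet-mulS-≈ (geomS (- + 1) y) R (jet-geomS (- + 1) y) R≈))))
  ( (begin
        _
      ≈⟨ solve 3 (λ x g r → 1+[-1] x :* (1+[-1] x :* (g :* (g :* r))) := ((1- x) :* g) :* ((1- x) :* g) :* r)
               (λ _ → refl) x G R₀ ⟩
        ((𝟙 ⊕ ⊝ x) ⊛ G) ⊛ ((𝟙 ⊕ ⊝ x) ⊛ G) ⊛ R₀
      ≈⟨ ⊛-cong (⊛-cong (geom-inverse y) (geom-inverse y)) (λ _ → refl) ⟩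
        𝟙 ⊛ 𝟙 ⊛ R₀
      ≈⟨ solve 1 (λ r → con (+ 1) :* con (+ 1) :* r := r) (λ _ → refl) R₀ ⟩
        R₀ ∎)
  , solve 4 (λ x g g₁ r → 1+[-1] x :* (1+[-1] x :*
               ((con (+ 1) :* g₁) :* (g :* r) :+ g :* ((con (- + 1) :* g₁) :* r :+ g :* con (+ 0)))) := con (+ 0))
            (λ _ → refl) x G G₁ R₀
  , (begin
        _
      ≈⟨ solve 6 (λ x g g₁ g₂ r₀ r₂ →
           1+[-1] x :* (1+[-1] x :*
             ((con (+ 1) :* g₂) :* (g :* r₀)
              :+ ((con (+ 1) :* g₁) :* ((con (- + 1) :* g₁) :* r₀ :+ g :* con (+ 0))
                  :+ (con (+ 1) :* g₁) :* ((con (- + 1) :* g₁) :* r₀ :+ g :* con (+ 0)))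
              :+ g :* ((con (+ 1) :* g₂) :* r₀
                       :+ ((con (- + 1) :* g₁) :* con (+ 0) :+ (con (- + 1) :* g₁) :* con (+ 0))
                       :+ g :* r₂)))
           := (1- x) :* (1- x) :* (g :* g₂ :- g₁ :* g₁) :* (r₀ :+ r₀) :+ ((1- x) :* g) :* ((1- x) :* g) :* r₂)
           (λ _ → refl) x G G₁ G₂ R₀ R₂ ⟩
        (𝟙 ⊕ ⊝ x) ⊛ (𝟙 ⊕ ⊝ x) ⊛ (G ⊛ G₂ ⊕ ⊝ (G₁ ⊛ G₁)) ⊛ (R₀ ⊕ R₀)
          ⊕ ((𝟙 ⊕ ⊝ x) ⊛ G) ⊛ ((𝟙 ⊕ ⊝ x) ⊛ G) ⊛ R₂
      ≈⟨ ⊕-cong (⊛-cong (geom-variance y) (λ _ → refl)) (⊛-cong (⊛-cong (geom-inverse y) (geom-inverse y)) (λ _ → refl)) ⟩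
        G₁ ⊛ (R₀ ⊕ R₀) ⊕ 𝟙 ⊛ 𝟙 ⊛ R₂
      ≈⟨ solve 3 (λ g₁ r₀ r₂ → g₁ :* (r₀ :+ r₀) :+ con (+ 1) :* con (+ 1) :* r₂ := r₂ :+ (g₁ :* r₀ :+ g₁ :* r₀))
               (λ _ → refl) G₁ R₀ R₂ ⟩
        R₂ ⊕ (G₁ ⊛ R₀ ⊕ G₁ ⊛ R₀) ∎) )
  where
  open ≗-Reasoning
  x : PowerSeries
  x = q^ y
  G G₁ G₂ : PowerSeries
  G  = geom y
  G₁ = geom₁ y
  G₂ = geom₂ y
  F₋ : Series
  F₋ = addS oneS (monoS (+ 0) (- + 1) y)
  1-_ 1+[-1]_ : ∀ {m} → Polynomial m → Polynomial m
  1- p = con (+ 1) :- p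
  1+[-1] p = con (+ 1) :+ con (- + 1) :* p

overpartitionFactor : ℕ → PowerSeries
overpartitionFactor i = (𝟙 ⊕ q^ i) ⊛ geom i

jet-block : ∀ r i .{{_ : NonZero r}} .{{_ : NonZero i}} R R₀ R₂ → jet R ≈ʲ ⟨ R₀ , 𝟘 , R₂ ⟩ →
  jet (foldr mulS R (factorsC r i))
    ≈ʲ overpartitionFactor i ·ʲ ⟨ R₀ , 𝟘 , R₂ ⊕ (geom₁ (r * i) ⊛ R₀ ⊕ geom₁ (r * i) ⊛ R₀) ⟩
jet-block r i R R₀ R₂ R≈ = ≈ʲ-trans
  (jet-scalar-mulS (addS oneS (monoS (+ 0) (+ 1) i)) (mulS (geomS (+ 0) i) (zDependentFactors (r * i) R))
    (jet-binomial (+ 1) i)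
    (jet-scalar-mulS (geomS (+ 0) i) (zDependentFactors (r * i) R) (jet-geomS₀ i)
      (jet-zDependentFactors (r * i) {{ℕ.m*n≢0 r i}} R R₀ R₂ R≈)))
  (regroup R₀ , regroup 𝟘 , regroup (R₂ ⊕ (geom₁ (r * i) ⊛ R₀ ⊕ geom₁ (r * i) ⊛ R₀)))
  where
  regroup : ∀ v → (𝟙 ⊕ constant (+ 1) ⊛ q^ i) ⊛ (geom i ⊛ v) ≗ overpartitionFactor i ⊛ v
  regroup v = solve 3 (λ x g v → (con (+ 1) :+ con (+ 1) :* x) :* (g :* v) := (con (+ 1) :+ x) :* g :* v)
                      (λ _ → refl) (q^ i) (geom i) v

∏overpartitionFactor : List ℕ → PowerSeries
∏overpartitionFactor []       = 𝟙
∏overpartitionFactor (j ∷ js) = overpartitionFactor (suc j) ⊛ ∏overpartitionFactor js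

∑geom₁ : ℕ → List ℕ → PowerSeries
∑geom₁ r []       = 𝟘
∑geom₁ r (j ∷ js) = geom₁ (r * suc j) ⊕ ∑geom₁ r js

jet-prodS-factorsC : ∀ r .{{_ : NonZero r}} js →
  jet (prodS (concatMap (factorsC r) (map suc js)))
    ≈ʲ ⟨ ∏overpartitionFactor js , 𝟘 , ∏overpartitionFactor js ⊛ (∑geom₁ r js ⊕ ∑geom₁ r js) ⟩
jet-prodS-factorsC r [] = ≈ʲ-trans jet-oneS
  ( (λ _ → refl) , (λ _ → refl)
  , solve 0 (con (+ 0) := con (+ 1) :* (con (+ 0) :+ con (+ 0))) (λ _ → refl) )
jet-prodS-factorsC r (j ∷ js) = ≈ʲ-trans
  (jet-block r (suc j) (prodS (concatMap (factorsC r) (map suc js))) Q (Q ⊛ (H ⊕ H)) (jet-prodS-factorsC r js))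
  ( (λ _ → refl)
  , solve 1 (λ a → a :* con (+ 0) := con (+ 0)) (λ _ → refl) A
  , solve 4 (λ a p h g → a :* (p :* (h :+ h) :+ (g :* p :+ g :* p)) := a :* p :* ((g :+ h) :+ (g :+ h)))
            (λ _ → refl) A Q H (geom₁ (r * suc j)) )
  where
  A Q H : PowerSeries
  A = overpartitionFactor (suc j)
  Q = ∏overpartitionFactor js
  H = ∑geom₁ r js

M2-formula : ∀ r .{{_ : NonZero r}} n → M2 r n ≡ (∏overpartitionFactor (upTo n) ⊛ (∑geom₁ r (upTo n) ⊕ ∑geom₁ r (upTo n))) n
M2-formula r n = proj₂ (proj₂ (jet-prodS-factorsC r (upTo n))) n

-- Generating functions of overpartitions

overpartitionGF : ℕ → PowerSeries
overpartitionGF zero    = 𝟙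
overpartitionGF (suc a) = overpartitionGF a ⊛ overpartitionFactor (suc a)

-- admissibleGF a counts the overpartitions into parts ≤ a + 1 in which a + 1 is not overlined.
admissibleGF : ℕ → PowerSeries
admissibleGF a = overpartitionGF a ⊛ geom (suc a)

overpartitionGF-expansion : ∀ a → overpartitionGF a ≗ 𝟙 ⊕ (shifts admissibleGF a ⊕ shifts admissibleGF a)
overpartitionGF-expansion zero    t = sym (ℤ.+-identityʳ (𝟙 t))
overpartitionGF-expansion (suc a) = begin
    P ⊛ ((𝟙 ⊕ x) ⊛ g)
  ≈⟨ solve 3 (λ p x g → p :* ((con (+ 1) :+ x) :* g) := p :* g :+ x :* (p :* g)) (λ _ → refl) P x g ⟩
    P ⊛ g ⊕ x ⊛ admissibleGF a
  ≈⟨ ⊕-cong (⊛-cong {P} (λ _ → refl) (geom-rec (suc a))) (λ _ → refl) ⟩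
    P ⊛ (𝟙 ⊕ x ⊛ g) ⊕ x ⊛ admissibleGF a
  ≈⟨ solve 3 (λ p x g → p :* (con (+ 1) :+ x :* g) :+ x :* (p :* g) := p :+ (x :* (p :* g) :+ x :* (p :* g)))
           (λ _ → refl) P x g ⟩
    P ⊕ (x ⊛ admissibleGF a ⊕ x ⊛ admissibleGF a)
  ≈⟨ ⊕-cong (overpartitionGF-expansion a) (λ _ → refl) ⟩
    𝟙 ⊕ (S ⊕ S) ⊕ (x ⊛ admissibleGF a ⊕ x ⊛ admissibleGF a)
  ≈⟨ solve 3 (λ o s d → o :+ (s :+ s) :+ (d :+ d) := o :+ ((s :+ d) :+ (s :+ d))) (λ _ → refl) 𝟙 S (x ⊛ admissibleGF a) ⟩
    𝟙 ⊕ ((S ⊕ x ⊛ admissibleGF a) ⊕ (S ⊕ x ⊛ admissibleGF a))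
  ≈⟨ ⊕-cong {𝟙} (λ _ → refl) (⊕-cong (shifts-suc admissibleGF a) (shifts-suc admissibleGF a)) ⟨
    𝟙 ⊕ (shifts admissibleGF (suc a) ⊕ shifts admissibleGF (suc a)) ∎
  where
  open ≗-Reasoning
  x g P S : PowerSeries
  x = q^ suc a
  g = geom (suc a)
  P = overpartitionGF a
  S = shifts admissibleGF a

admissibleGF-expansion : ∀ a → admissibleGF a ≗ 𝟙 ⊕ (shifts admissibleGF (suc a) ⊕ shifts admissibleGF a)
admissibleGF-expansion a = begin
    P ⊛ g
  ≈⟨ ⊛-cong {P} (λ _ → refl) (geom-rec (suc a)) ⟩
    P ⊛ (𝟙 ⊕ x ⊛ g)
  ≈⟨ solve 3 (λ p x g → p :* (con (+ 1) :+ x :* g) := p :+ x :* (p :* g)) (λ _ → refl) P x g ⟩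
    P ⊕ x ⊛ admissibleGF a
  ≈⟨ ⊕-cong (overpartitionGF-expansion a) (λ _ → refl) ⟩
    𝟙 ⊕ (S ⊕ S) ⊕ x ⊛ admissibleGF a
  ≈⟨ solve 3 (λ o s d → o :+ (s :+ s) :+ d := o :+ ((s :+ d) :+ s)) (λ _ → refl) 𝟙 S (x ⊛ admissibleGF a) ⟩
    𝟙 ⊕ ((S ⊕ x ⊛ admissibleGF a) ⊕ S)
  ≈⟨ ⊕-cong {𝟙} (λ _ → refl) (⊕-cong (shifts-suc admissibleGF a) (λ _ → refl)) ⟨
    𝟙 ⊕ (shifts admissibleGF (suc a) ⊕ S) ∎
  where
  open ≗-Reasoning
  x g P S : PowerSeries
  x = q^ suc a
  g = geom (suc a)
  P = overpartitionGF a
  S = shifts admissibleGF a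

∏overpartitionFactor-snoc : ∀ js j → ∏overpartitionFactor (js ∷ʳ j) ≗ ∏overpartitionFactor js ⊛ overpartitionFactor (suc j)
∏overpartitionFactor-snoc []       j = solve 1 (λ a → a :* con (+ 1) := con (+ 1) :* a) (λ _ → refl) (overpartitionFactor (suc j))
∏overpartitionFactor-snoc (i ∷ js) j = begin
    overpartitionFactor (suc i) ⊛ ∏overpartitionFactor (js ∷ʳ j)
  ≈⟨ ⊛-cong {overpartitionFactor (suc i)} (λ _ → refl) (∏overpartitionFactor-snoc js j) ⟩
    overpartitionFactor (suc i) ⊛ (∏overpartitionFactor js ⊛ overpartitionFactor (suc j))
  ≈⟨ ⊛-assoc (overpartitionFactor (suc i)) (∏overpartitionFactor js) (overpartitionFactor (suc j)) ⟨
    overpartitionFactor (suc i) ⊛ ∏overpartitionFactor js ⊛ overpartitionFactor (suc j) ∎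
  where open ≗-Reasoning

overpartitionGF≗∏overpartitionFactor : ∀ n → overpartitionGF n ≗ ∏overpartitionFactor (upTo n)
overpartitionGF≗∏overpartitionFactor zero    = λ _ → refl
overpartitionGF≗∏overpartitionFactor (suc n) = begin
    overpartitionGF n ⊛ overpartitionFactor (suc n)
  ≈⟨ ⊛-cong (overpartitionGF≗∏overpartitionFactor n) (λ _ → refl) ⟩
    ∏overpartitionFactor (upTo n) ⊛ overpartitionFactor (suc n)
  ≈⟨ ∏overpartitionFactor-snoc (upTo n) n ⟨
    ∏overpartitionFactor (upTo n ∷ʳ n)
  ≈⟨ (λ t → cong (λ js → ∏overpartitionFactor js t) (List.upTo-∷ʳ n)) ⟩
    ∏overpartitionFactor (upTo (suc n)) ∎
  where open ≗-Reasoning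

-- With R m = q^m/(1+q^m), weightedAdmissibleGF a sums w over the overlined parts of the overpartitions
-- counted by admissibleGF a.
module WeightedGF (w : ℕ → ℤ) (R : ℕ → PowerSeries)
                  (R-spec : ∀ m → (𝟙 ⊕ q^ suc m) ⊛ R (suc m) ≗ q^ suc m) where

  overlinedWeightGF : ℕ → PowerSeries
  overlinedWeightGF zero    = 𝟘
  overlinedWeightGF (suc a) = overlinedWeightGF a ⊕ constant (w (suc a)) ⊛ R (suc a)

  weightedAdmissibleGF : ℕ → PowerSeries
  weightedAdmissibleGF a = overpartitionGF a ⊛ overlinedWeightGF a ⊛ geom (suc a)

  weightedShift : ℕ → PowerSeries
  weightedShift i = constant (w (suc i)) ⊛ (q^ suc i ⊛ admissibleGF i)

  weightedOverpartitionGF-expansion : ∀ a → overpartitionGF a ⊛ overlinedWeightGF a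
    ≗ (shifts weightedAdmissibleGF a ⊕ shifts weightedAdmissibleGF a) ⊕ ∑ˢ a weightedShift
  weightedOverpartitionGF-expansion zero t = trans (𝟙-⊛ 𝟘 t) (𝟘-at t)
  weightedOverpartitionGF-expansion (suc a) = begin
      P ⊛ ((𝟙 ⊕ x) ⊛ g) ⊛ (B ⊕ c ⊛ R (suc a))
    ≈⟨ solve 6 (λ p b x g c r → p :* ((con (+ 1) :+ x) :* g) :* (b :+ c :* r)
                 := (p :* b) :* (g :+ x :* g) :+ c :* (p :* g) :* ((con (+ 1) :+ x) :* r))
             (λ _ → refl) P B x g c (R (suc a)) ⟩
      (P ⊛ B) ⊛ (g ⊕ x ⊛ g) ⊕ c ⊛ admissibleGF a ⊛ ((𝟙 ⊕ x) ⊛ R (suc a))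
    ≈⟨ ⊕-cong (⊛-cong {P ⊛ B} (λ _ → refl) (⊕-cong (geom-rec (suc a)) (λ _ → refl)))
              (⊛-cong {c ⊛ admissibleGF a} (λ _ → refl) (R-spec a)) ⟩
      (P ⊛ B) ⊛ ((𝟙 ⊕ x ⊛ g) ⊕ x ⊛ g) ⊕ c ⊛ admissibleGF a ⊛ x
    ≈⟨ solve 6 (λ p b x g c d → (p :* b) :* ((con (+ 1) :+ x :* g) :+ x :* g) :+ c :* d :* x
                 := p :* b :+ (x :* (p :* b :* g) :+ x :* (p :* b :* g)) :+ c :* (x :* d))
             (λ _ → refl) P B x g c (admissibleGF a) ⟩
      P ⊛ B ⊕ (x ⊛ W ⊕ x ⊛ W) ⊕ weightedShift a
    ≈⟨ ⊕-cong (⊕-cong (weightedOverpartitionGF-expansion a) (λ _ → refl)) (λ _ → refl) ⟩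
      (S ⊕ S) ⊕ ∑ˢ a weightedShift ⊕ (x ⊛ W ⊕ x ⊛ W) ⊕ weightedShift a
    ≈⟨ solve 4 (λ s t v e → (s :+ s) :+ t :+ (v :+ v) :+ e := ((s :+ v) :+ (s :+ v)) :+ (t :+ e))
             (λ _ → refl) S (∑ˢ a weightedShift) (x ⊛ W) (weightedShift a) ⟩
      ((S ⊕ x ⊛ W) ⊕ (S ⊕ x ⊛ W)) ⊕ (∑ˢ a weightedShift ⊕ weightedShift a)
    ≈⟨ ⊕-cong (⊕-cong (shifts-suc weightedAdmissibleGF a) (shifts-suc weightedAdmissibleGF a))
              (∑ˢ-snoc a weightedShift) ⟨
      (shifts weightedAdmissibleGF (suc a) ⊕ shifts weightedAdmissibleGF (suc a)) ⊕ ∑ˢ (suc a) weightedShift ∎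
    where
    open ≗-Reasoning
    x g c P B W S : PowerSeries
    x = q^ suc a
    g = geom (suc a)
    c = constant (w (suc a))
    P = overpartitionGF a
    B = overlinedWeightGF a
    W = weightedAdmissibleGF a
    S = shifts weightedAdmissibleGF a

  weightedAdmissibleGF-expansion : ∀ a → weightedAdmissibleGF a
    ≗ (shifts weightedAdmissibleGF (suc a) ⊕ shifts weightedAdmissibleGF a) ⊕ ∑ˢ a weightedShift
  weightedAdmissibleGF-expansion a = begin
      P ⊛ B ⊛ g
    ≈⟨ ⊛-cong {P ⊛ B} (λ _ → refl) (geom-rec (suc a)) ⟩
      P ⊛ B ⊛ (𝟙 ⊕ x ⊛ g)
    ≈⟨ solve 3 (λ y x g → y :* (con (+ 1) :+ x :* g) := y :+ x :* (y :* g)) (λ _ → refl) (P ⊛ B) x g ⟩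
      P ⊛ B ⊕ x ⊛ weightedAdmissibleGF a
    ≈⟨ ⊕-cong (weightedOverpartitionGF-expansion a) (λ _ → refl) ⟩
      (S ⊕ S) ⊕ ∑ˢ a weightedShift ⊕ x ⊛ weightedAdmissibleGF a
    ≈⟨ solve 3 (λ s t v → (s :+ s) :+ t :+ v := ((s :+ v) :+ s) :+ t)
               (λ _ → refl) S (∑ˢ a weightedShift) (x ⊛ weightedAdmissibleGF a) ⟩
      ((S ⊕ x ⊛ weightedAdmissibleGF a) ⊕ S) ⊕ ∑ˢ a weightedShift
    ≈⟨ ⊕-cong (⊕-cong (shifts-suc weightedAdmissibleGF a) (λ _ → refl)) (λ _ → refl) ⟨
      (shifts weightedAdmissibleGF (suc a) ⊕ S) ⊕ ∑ˢ a weightedShift ∎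
    where
    open ≗-Reasoning
    x g P B S : PowerSeries
    x = q^ suc a
    g = geom (suc a)
    P = overpartitionGF a
    B = overlinedWeightGF a
    S = shifts weightedAdmissibleGF a

-- Overpartitions by their largest part

Fits : ℕ → ℕ → Part → Set
Fits a n p = Positive p × AdjOK (a , false) p × proj₁ p ≤ n

fits? : ∀ a n p → Dec (Fits a n p)
fits? a n p = (1 ℕ.≤? proj₁ p) ×-dec adjOK? (a , false) p ×-dec (proj₁ p ℕ.≤? n)

Admissible : ℕ → ℕ → List Part → Set
Admissible a n []       = n ≡ 0
Admissible a n (p ∷ ps) = Fits a n p × Admissible (proj₁ p) (n ∸ proj₁ p) ps

admissible? : ∀ a n ps → Dec (Admissible a n ps)
admissible? a n []       = n ℕ.≟ 0
admissible? a n (p ∷ ps) = fits? a n p ×-dec admissible? (proj₁ p) (n ∸ proj₁ p) ps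

fits-plain : ∀ a n i → does (fits? (suc a) n (suc i , false)) ≡ does (i ℕ.<? suc a) ∧ does (suc i ℕ.≤? n)
fits-plain a n i = does-⇔ (mk⇔ (λ (_ , (i≤a , _) , 1+i≤n) → i≤a , 1+i≤n)
                                (λ (i≤a , 1+i≤n) → s≤s z≤n , (i≤a , λ ()) , 1+i≤n))
                          (fits? (suc a) n (suc i , false)) ((i ℕ.<? suc a) ×-dec (suc i ℕ.≤? n))

fits-overlined : ∀ a n i → does (fits? (suc a) n (suc i , true)) ≡ does (i ℕ.<? a) ∧ does (suc i ℕ.≤? n)
fits-overlined a n i = does-⇔
  (mk⇔ (λ (_ , (1+i≤1+a , a≢i) , 1+i≤n) →
          ℕ.≤∧≢⇒< (ℕ.s≤s⁻¹ 1+i≤1+a) (λ i≡a → a≢i refl (cong suc (sym i≡a))) , 1+i≤n)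
       (λ (i<a , 1+i≤n) → s≤s z≤n , (s≤s (ℕ.<⇒≤ i<a) , λ _ a≡i → ℕ.<-irrefl (ℕ.suc-injective (sym a≡i)) i<a) , 1+i≤n))
  (fits? (suc a) n (suc i , true)) ((i ℕ.<? a) ×-dec (suc i ℕ.≤? n))

weight-cons⇔ : ∀ b w n → (b ℕ.+ w ≡ n) ⇔ (b ≤ n × w ≡ n ∸ b)
weight-cons⇔ b w n = mk⇔
  (λ { refl → ℕ.m≤m+n b w , sym (ℕ.m+n∸m≡n b w) })
  (λ { (b≤n , refl) → ℕ.m+[n∸m]≡n b≤n })

-- AdjOK ignores the flag of its first argument, hence the arbitrary o.
tail-admissible⇔ : ∀ a o n ps →
  (All Positive ps × Linked AdjOK ((a , o) ∷ ps) × weight ps ≡ n) ⇔ Admissible a n ps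
tail-admissible⇔ a o n [] = mk⇔ (λ (_ , _ , w≡n) → sym w≡n) (λ n≡0 → [] , [-] , sym n≡0)
tail-admissible⇔ a o n ((b , o′) ∷ ps) = mk⇔
  (λ { (pos ∷ poss , adj ∷ link , w≡n) →
         let b≤n , w′≡ = Equivalence.to (weight-cons⇔ b (weight ps) n) w≡n in
         (pos , adj , b≤n) , Equivalence.to (tail-admissible⇔ b o′ (n ∸ b) ps) (poss , link , w′≡) })
  (λ { ((pos , adj , b≤n) , adm) →
         let poss , link , w′≡ = Equivalence.from (tail-admissible⇔ b o′ (n ∸ b) ps) adm in
         pos ∷ poss , adj ∷ link , Equivalence.from (weight-cons⇔ b (weight ps) n) (b≤n , w′≡) })

isOverpartition⇔admissible : ∀ n ps → IsOverpartition n ps ⇔ Admissible (suc n) n ps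
isOverpartition⇔admissible n ps = mk⇔
  (λ (poss , link , w≡n) → Equivalence.to (tail-admissible⇔ (suc n) false n ps) (poss , extend ps link w≡n , w≡n))
  (λ adm → let poss , link , w≡n = Equivalence.from (tail-admissible⇔ (suc n) false n ps) adm in
           poss , Linked.tail link , w≡n)
  where
  extend : ∀ ps → Linked AdjOK ps → weight ps ≡ n → Linked AdjOK ((suc n , false) ∷ ps)
  extend []              _    _    = [-]
  extend ((b , o) ∷ ps) link refl = (ℕ.m≤n⇒m≤1+n b≤n , λ _ 1+n≡b → ℕ.<-irrefl (sym 1+n≡b) (s≤s b≤n)) ∷ link
    where
    b≤n : b ≤ weight ((b , o) ∷ ps)
    b≤n = ℕ.m≤m+n b (weight ps)

isOverpartition?≡admissible? : ∀ n ps → ⌊ isOverpartition? n ps ⌋ ≡ does (admissible? (suc n) n ps)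
isOverpartition?≡admissible? n ps =
  trans (isYes≗does (isOverpartition? n ps)) (does-⇔ (isOverpartition⇔admissible n ps) (isOverpartition? n ps) (admissible? (suc n) n ps))

∑ₗ-alphabet : ∀ N (H : Part → ℤ) → ∑ₗ (alphabet N) H ≡ sumTo N (λ i → H (suc i , false) + H (suc i , true))
∑ₗ-alphabet N H = begin
    ∑ₗ (alphabet N) H
  ≡⟨ ∑ₗ-concatMap (λ a → (a , false) ∷ (a , true) ∷ []) (map suc (upTo N)) H ⟩
    ∑ₗ (map suc (upTo N)) (λ a → H (a , false) + (H (a , true) + + 0))
  ≡⟨ ∑ₗ-map suc (upTo N) (λ a → H (a , false) + (H (a , true) + + 0)) ⟩
    ∑ₗ (upTo N) (λ i → H (suc i , false) + (H (suc i , true) + + 0))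
  ≡⟨ ∑ₗ-applyUpTo N (λ i → i) (λ i → H (suc i , false) + (H (suc i , true) + + 0)) ⟩
    sumTo N (λ i → H (suc i , false) + (H (suc i , true) + + 0))
  ≡⟨ sumTo-cong N (λ i → cong (λ s → H (suc i , false) + s) (ℤ.+-identityʳ (H (suc i , true)))) ⟩
    sumTo N (λ i → H (suc i , false) + H (suc i , true)) ∎
  where open ≡-Reasoning

tail-bounds : ∀ {L n N} i → n ≤ suc L → n ≤ N → n ∸ suc i ≤ L × n ∸ suc i ≤ N
tail-bounds {L} {n} i n≤1+L n≤N =
  ℕ.≤-trans (ℕ.∸-monoˡ-≤ (suc i) n≤1+L) (ℕ.m∸n≤m L i) , ℕ.≤-trans (ℕ.m∸n≤m n (suc i)) n≤N

module _ (N : ℕ) where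

  ∑adm : ℕ → ℕ → ℕ → (List Part → ℤ) → ℤ
  ∑adm ℓ a n F = ∑ₗ (listsOfLength ℓ (alphabet N)) (λ ps → when (does (admissible? a n ps)) (F ps))

  ∑adm-from : ℕ → ℕ → ℕ → (List Part → ℤ) → Part → ℤ
  ∑adm-from ℓ a n F p = when (does (fits? a n p)) (∑adm ℓ (proj₁ p) (n ∸ proj₁ p) (λ ps → F (p ∷ ps)))

  ∑adm-suc : ∀ ℓ a n F → ∑adm (suc ℓ) a n F
    ≡ sumTo N (λ i → ∑adm-from ℓ a n F (suc i , false) + ∑adm-from ℓ a n F (suc i , true))
  ∑adm-suc ℓ a n F = begin
      ∑adm (suc ℓ) a n F
    ≡⟨ ∑ₗ-concatMap (λ p → map (p ∷_) (listsOfLength ℓ (alphabet N))) (alphabet N) G ⟩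
      ∑ₗ (alphabet N) (λ p → ∑ₗ (map (p ∷_) (listsOfLength ℓ (alphabet N))) G)
    ≡⟨ ∑ₗ-cong (alphabet N) (λ p → trans (∑ₗ-map (p ∷_) (listsOfLength ℓ (alphabet N)) G)
         (trans (∑ₗ-cong (listsOfLength ℓ (alphabet N)) (λ ps → when-∧ (does (fits? a n p)) _ (F (p ∷ ps))))
                (∑ₗ-when (listsOfLength ℓ (alphabet N)) (does (fits? a n p)) _))) ⟩
      ∑ₗ (alphabet N) (∑adm-from ℓ a n F)
    ≡⟨ ∑ₗ-alphabet N (∑adm-from ℓ a n F) ⟩
      sumTo N (λ i → ∑adm-from ℓ a n F (suc i , false) + ∑adm-from ℓ a n F (suc i , true)) ∎
    where
    open ≡-Reasoning
    G : List Part → ℤ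
    G ps = when (does (admissible? a n ps)) (F ps)

  ∑adm≤ : ℕ → ℕ → ℕ → (List Part → ℤ) → ℤ
  ∑adm≤ L a n F = sumTo (suc L) (λ ℓ → ∑adm ℓ a n F)

  ∑adm≤-tail : ℕ → ℕ → (List Part → ℤ) → Part → ℤ
  ∑adm≤-tail L n F p = ∑adm≤ L (proj₁ p) (n ∸ proj₁ p) (λ ps → F (p ∷ ps))

  ∑adm≤-suc : ∀ L a n F → ∑adm≤ (suc L) (suc a) n F
    ≡ ∑adm 0 (suc a) n F
      + sumTo N (λ i → when (does (i ℕ.<? suc a)) (when (does (suc i ℕ.≤? n)) (∑adm≤-tail L n F (suc i , false)))
                       + when (does (i ℕ.<? a)) (when (does (suc i ℕ.≤? n)) (∑adm≤-tail L n F (suc i , true))))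
  ∑adm≤-suc L a n F = cong (λ s → ∑adm 0 (suc a) n F + s) (begin
      sumTo (suc L) (λ ℓ → ∑adm (suc ℓ) (suc a) n F)
    ≡⟨ sumTo-cong (suc L) (λ ℓ → ∑adm-suc ℓ (suc a) n F) ⟩
      sumTo (suc L) (λ ℓ → sumTo N (λ i → from ℓ (suc i , false) + from ℓ (suc i , true)))
    ≡⟨ sumTo-comm (suc L) N (λ ℓ i → from ℓ (suc i , false) + from ℓ (suc i , true)) ⟩
      sumTo N (λ i → sumTo (suc L) (λ ℓ → from ℓ (suc i , false) + from ℓ (suc i , true)))
    ≡⟨ sumTo-cong N (λ i → trans (sumTo-distrib-+ (suc L) (λ ℓ → from ℓ (suc i , false)) (λ ℓ → from ℓ (suc i , true)))
                                  (cong₂ _+_ (split (suc i , false) (does (i ℕ.<? suc a)) (does (suc i ℕ.≤? n)) (fits-plain a n i))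
                                             (split (suc i , true) (does (i ℕ.<? a)) (does (suc i ℕ.≤? n)) (fits-overlined a n i)))) ⟩
      sumTo N (λ i → when (does (i ℕ.<? suc a)) (when (does (suc i ℕ.≤? n)) (∑adm≤-tail L n F (suc i , false)))
                   + when (does (i ℕ.<? a)) (when (does (suc i ℕ.≤? n)) (∑adm≤-tail L n F (suc i , true)))) ∎)
    where
    open ≡-Reasoning
    from : ℕ → Part → ℤ
    from ℓ = ∑adm-from ℓ (suc a) n F
    split : ∀ p c d → does (fits? (suc a) n p) ≡ c ∧ d →
            sumTo (suc L) (λ ℓ → from ℓ p) ≡ when c (when d (∑adm≤-tail L n F p))
    split p c d fits≡ = begin
        sumTo (suc L) (λ ℓ → from ℓ p)
      ≡⟨ sumTo-cong (suc L) (λ ℓ → trans (cong (λ b → when b (X ℓ)) fits≡) (when-∧ c d (X ℓ))) ⟩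
        sumTo (suc L) (λ ℓ → when c (when d (X ℓ)))
      ≡⟨ trans (sumTo-when (suc L) c (λ ℓ → when d (X ℓ))) (cong (when c) (sumTo-when (suc L) d X)) ⟩
        when c (when d (∑adm≤-tail L n F p)) ∎
      where
      X : ℕ → ℤ
      X ℓ = ∑adm ℓ (proj₁ p) (n ∸ proj₁ p) (λ ps → F (p ∷ ps))

  count : ℕ → ℕ → ℕ → ℤ
  count L a n = ∑adm≤ L a n (λ _ → + 1)

  -- Both sides obey the recursion obtained by removing the largest part; induct on the length bound L ≥ n.
  count-unique : ∀ (X : ℕ → PowerSeries) → (∀ a → X a ≗ 𝟙 ⊕ (shifts X (suc a) ⊕ shifts X a)) →
    ∀ L a n → n ≤ L → n ≤ N → count L (suc a) n ≡ X a n
  count-unique X X-exp zero a zero _ _ = sym (trans (X-exp a 0)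
    (cong (λ s → 𝟙 0 + s) (cong₂ _+_ (shifts-at-0 X (suc a)) (shifts-at-0 X a))))
  count-unique X X-exp (suc L) a n n≤1+L n≤N = begin
      count (suc L) (suc a) n
    ≡⟨ ∑adm≤-suc L a n (λ _ → + 1) ⟩
      when (does (n ℕ.≟ 0)) (+ 1) + + 0 + sumTo N (λ i → when (does (i ℕ.<? suc a)) (T i) + when (does (i ℕ.<? a)) (T i))
    ≡⟨ cong₂ _+_ (ℤ.+-identityʳ (𝟙 n))
                 (sumTo-cong N (λ i → cong₂ _+_ (cong (when (does (i ℕ.<? suc a))) (shifted i))
                                                (cong (when (does (i ℕ.<? a))) (shifted i)))) ⟩
      𝟙 n + sumTo N (λ i → when (does (i ℕ.<? suc a)) (S i) + when (does (i ℕ.<? a)) (S i))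
    ≡⟨ cong (λ s → 𝟙 n + s) (sumTo-when-<-pair a S S n≤N (q^suc-⊛-vanishes X n) (q^suc-⊛-vanishes X n)) ⟩
      𝟙 n + (shifts X (suc a) n + shifts X a n)
    ≡⟨ X-exp a n ⟨
      X a n ∎
    where
    open ≡-Reasoning
    T S : ℕ → ℤ
    T i = when (does (suc i ℕ.≤? n)) (count L (suc i) (n ∸ suc i))
    S i = (q^ suc i ⊛ X i) n
    shifted : ∀ i → when (does (suc i ℕ.≤? n)) (count L (suc i) (n ∸ suc i)) ≡ S i
    shifted i = trans (cong (when (does (suc i ℕ.≤? n))) (count-unique X X-exp L i (n ∸ suc i) (proj₁ bounds) (proj₂ bounds)))
                      (sym (q^-⊛ (suc i) (X i) n))
      where
      bounds : n ∸ suc i ≤ L × n ∸ suc i ≤ N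
      bounds = tail-bounds i n≤1+L n≤N

  ∑adm≤-affine : ∀ L a n c (G : List Part → ℤ) →
    ∑adm≤ L a n (λ ps → c + G ps) ≡ c *ℤ count L a n + ∑adm≤ L a n G
  ∑adm≤-affine L a n c G = begin
      sumTo (suc L) (λ ℓ → ∑adm ℓ a n (λ ps → c + G ps))
    ≡⟨ sumTo-cong (suc L) level ⟩
      sumTo (suc L) (λ ℓ → c *ℤ ∑adm ℓ a n (λ _ → + 1) + ∑adm ℓ a n G)
    ≡⟨ sumTo-distrib-+ (suc L) (λ ℓ → c *ℤ ∑adm ℓ a n (λ _ → + 1)) (λ ℓ → ∑adm ℓ a n G) ⟩
      sumTo (suc L) (λ ℓ → c *ℤ ∑adm ℓ a n (λ _ → + 1)) + ∑adm≤ L a n G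
    ≡⟨ cong (_+ ∑adm≤ L a n G) (sumTo-*ˡ (suc L) c (λ ℓ → ∑adm ℓ a n (λ _ → + 1))) ⟩
      c *ℤ count L a n + ∑adm≤ L a n G ∎
    where
    open ≡-Reasoning
    level : ∀ ℓ → ∑adm ℓ a n (λ ps → c + G ps) ≡ c *ℤ ∑adm ℓ a n (λ _ → + 1) + ∑adm ℓ a n G
    level ℓ = begin
        ∑ₗ Ls (λ ps → when (adm ps) (c + G ps))
      ≡⟨ ∑ₗ-cong Ls (λ ps → trans (when-+ (adm ps) c (G ps))
                                   (cong (_+ when (adm ps) (G ps)) (scale (adm ps)))) ⟩
        ∑ₗ Ls (λ ps → c *ℤ when (adm ps) (+ 1) + when (adm ps) (G ps))
      ≡⟨ trans (∑ₗ-distrib-+ Ls (λ ps → c *ℤ when (adm ps) (+ 1)) (λ ps → when (adm ps) (G ps)))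
               (cong (_+ ∑adm ℓ a n G) (∑ₗ-*ˡ Ls c (λ ps → when (adm ps) (+ 1)))) ⟩
        c *ℤ ∑adm ℓ a n (λ _ → + 1) + ∑adm ℓ a n G ∎
      where
      Ls : List (List Part)
      Ls = listsOfLength ℓ (alphabet N)
      adm : List Part → Bool
      adm ps = does (admissible? a n ps)
      scale : ∀ b → when b c ≡ c *ℤ when b (+ 1)
      scale true  = sym (ℤ.*-identityʳ c)
      scale false = sym (ℤ.*-zeroʳ c)

overlinedWeight : ℕ → ℕ → ℤ
overlinedWeight k b = + (if ⌊ k ∣? b ⌋ then b else 0)

module _ (N k : ℕ) where

  weigh : ℕ → ℕ → ℕ → ℤ
  weigh L a n = ∑adm≤ N L a n (λ ps → + ovPartsDiv k ps)

  overlined-head : ∀ (X Y : ℕ → PowerSeries) L i n →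
    count N L (suc i) (n ∸ suc i) ≡ X i (n ∸ suc i) → weigh L (suc i) (n ∸ suc i) ≡ Y i (n ∸ suc i) →
    when (does (suc i ℕ.≤? n)) (∑adm≤ N L (suc i) (n ∸ suc i) (λ ps → overlinedWeight k (suc i) + + ovPartsDiv k ps))
      ≡ overlinedWeight k (suc i) *ℤ (q^ suc i ⊛ X i) n + (q^ suc i ⊛ Y i) n
  overlined-head X Y L i n count≡ weigh≡ = begin
      when c (∑adm≤ N L (suc i) m (λ ps → w + + ovPartsDiv k ps))
    ≡⟨ cong (when c) (∑adm≤-affine N L (suc i) m w (λ ps → + ovPartsDiv k ps)) ⟩
      when c (w *ℤ count N L (suc i) m + weigh L (suc i) m)
    ≡⟨ cong (when c) (cong₂ (λ u v → w *ℤ u + v) count≡ weigh≡) ⟩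
      when c (w *ℤ X i m + Y i m)
    ≡⟨ trans (when-+ c (w *ℤ X i m) (Y i m)) (cong (_+ when c (Y i m)) (when-*ʳ c w (X i m))) ⟩
      w *ℤ when c (X i m) + when c (Y i m)
    ≡⟨ cong₂ (λ u v → w *ℤ u + v) (sym (q^-⊛ (suc i) (X i) n)) (sym (q^-⊛ (suc i) (Y i) n)) ⟩
      w *ℤ (q^ suc i ⊛ X i) n + (q^ suc i ⊛ Y i) n ∎
    where
    open ≡-Reasoning
    w : ℤ
    w = overlinedWeight k (suc i)
    c : Bool
    c = does (suc i ℕ.≤? n)
    m : ℕ
    m = n ∸ suc i

  weigh-unique : ∀ (X Y : ℕ → PowerSeries) →
    (∀ a → X a ≗ 𝟙 ⊕ (shifts X (suc a) ⊕ shifts X a)) →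
    (∀ a → Y a ≗ (shifts Y (suc a) ⊕ shifts Y a) ⊕ ∑ˢ a (λ i → constant (overlinedWeight k (suc i)) ⊛ (q^ suc i ⊛ X i))) →
    ∀ L a n → n ≤ L → n ≤ N → weigh L (suc a) n ≡ Y a n
  weigh-unique X Y X-exp Y-exp zero a zero _ _ = sym (trans (Y-exp a 0)
    (cong₂ _+_ (cong₂ _+_ (shifts-at-0 Y (suc a)) (shifts-at-0 Y a))
               (sumTo-zero a (λ i _ → trans (constant-⊛ (w i) (q^ suc i ⊛ X i) 0)
                                            (trans (cong (w i *ℤ_) (q^suc-⊛-vanishes X 0 i z≤n)) (ℤ.*-zeroʳ (w i)))))))
    where
    w : ℕ → ℤ
    w i = overlinedWeight k (suc i)
  weigh-unique X Y X-exp Y-exp (suc L) a n n≤1+L n≤N = begin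
      weigh (suc L) (suc a) n
    ≡⟨ ∑adm≤-suc N L a n (λ ps → + ovPartsDiv k ps) ⟩
      when (does (n ℕ.≟ 0)) (+ 0) + + 0
        + sumTo N (λ i → when (does (i ℕ.<? suc a)) (when (does (suc i ℕ.≤? n)) (weigh L (suc i) (n ∸ suc i)))
                       + when (does (i ℕ.<? a)) (when (does (suc i ℕ.≤? n)) (∑adm≤ N L (suc i) (n ∸ suc i) (λ ps → w i + + ovPartsDiv k ps))))
    ≡⟨ cong₂ _+_ (cong (_+ + 0) (when-0 (does (n ℕ.≟ 0))))
                 (sumTo-cong N (λ i → cong₂ _+_ (cong (when (does (i ℕ.<? suc a))) (shifted-weigh i))
                                                 (cong (when (does (i ℕ.<? a))) (shifted-affine i)))) ⟩
      + 0 + sumTo N (λ i → when (does (i ℕ.<? suc a)) (SY i) + when (does (i ℕ.<? a)) (T i))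
    ≡⟨ cong (λ s → + 0 + s) (trans (sumTo-when-<-pair a SY T n≤N (q^suc-⊛-vanishes Y n) T-vanishes)
                                   (cong (λ s → shifts Y (suc a) n + s) (sumTo-distrib-+ a (λ i → w i *ℤ SX i) SY))) ⟩
      + 0 + (shifts Y (suc a) n + (sumTo a (λ i → w i *ℤ SX i) + shifts Y a n))
    ≡⟨ regroup (shifts Y (suc a) n) (sumTo a (λ i → w i *ℤ SX i)) (shifts Y a n) ⟩
      shifts Y (suc a) n + shifts Y a n + sumTo a (λ i → w i *ℤ SX i)
    ≡⟨ cong (λ s → shifts Y (suc a) n + shifts Y a n + s) (sumTo-cong a (λ i → sym (constant-⊛ (w i) (q^ suc i ⊛ X i) n))) ⟩
      ((shifts Y (suc a) ⊕ shifts Y a) ⊕ ∑ˢ a (λ i → constant (w i) ⊛ (q^ suc i ⊛ X i))) n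
    ≡⟨ Y-exp a n ⟨
      Y a n ∎
    where
    open ≡-Reasoning
    w SX SY T : ℕ → ℤ
    w i = overlinedWeight k (suc i)
    SX i = (q^ suc i ⊛ X i) n
    SY i = (q^ suc i ⊛ Y i) n
    T i = w i *ℤ SX i + SY i
    T-vanishes : ∀ i → n ≤ i → T i ≡ + 0
    T-vanishes i n≤i = trans (cong₂ (λ u v → w i *ℤ u + v) (q^suc-⊛-vanishes X n i n≤i) (q^suc-⊛-vanishes Y n i n≤i))
                             (cong (_+ + 0) (ℤ.*-zeroʳ (w i)))
    regroup : ∀ p s t → + 0 + (p + (s + t)) ≡ p + t + s
    regroup = solve-∀
    shifted-weigh : ∀ i → when (does (suc i ℕ.≤? n)) (weigh L (suc i) (n ∸ suc i)) ≡ SY i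
    shifted-weigh i = trans (cong (when (does (suc i ℕ.≤? n)))
                                  (weigh-unique X Y X-exp Y-exp L i (n ∸ suc i) (proj₁ bounds) (proj₂ bounds)))
                            (sym (q^-⊛ (suc i) (Y i) n))
      where
      bounds : n ∸ suc i ≤ L × n ∸ suc i ≤ N
      bounds = tail-bounds i n≤1+L n≤N
    shifted-affine : ∀ i → when (does (suc i ℕ.≤? n)) (∑adm≤ N L (suc i) (n ∸ suc i) (λ ps → w i + + ovPartsDiv k ps))
                           ≡ T i
    shifted-affine i = overlined-head X Y L i n
      (count-unique N X X-exp L i (n ∸ suc i) (proj₁ bounds) (proj₂ bounds))
      (weigh-unique X Y X-exp Y-exp L i (n ∸ suc i) (proj₁ bounds) (proj₂ bounds))
      where
      bounds : n ∸ suc i ≤ L × n ∸ suc i ≤ N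
      bounds = tail-bounds i n≤1+L n≤N

ov-as-∑adm≤ : ∀ k n → + ov k n ≡ ∑adm≤ n n (suc n) n (λ ps → + ovPartsDiv k ps)
ov-as-∑adm≤ k n = begin
    + ov k n
  ≡⟨ ∑ₗ-pos (candidates n) (λ ps → if ⌊ isOverpartition? n ps ⌋ then ovPartsDiv k ps else 0) ⟩
    ∑ₗ (candidates n) (λ ps → + (if ⌊ isOverpartition? n ps ⌋ then ovPartsDiv k ps else 0))
  ≡⟨ ∑ₗ-cong (candidates n) (λ ps → trans (pos-if ⌊ isOverpartition? n ps ⌋)
                                          (cong (λ b → when b (+ ovPartsDiv k ps)) (isOverpartition?≡admissible? n ps))) ⟩
    ∑ₗ (candidates n) (λ ps → when (does (admissible? (suc n) n ps)) (+ ovPartsDiv k ps))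
  ≡⟨ ∑ₗ-concatMap (λ ℓ → listsOfLength ℓ (alphabet n)) (upTo (suc n))
                  (λ ps → when (does (admissible? (suc n) n ps)) (+ ovPartsDiv k ps)) ⟩
    ∑ₗ (upTo (suc n)) (λ ℓ → ∑adm n ℓ (suc n) n (λ ps → + ovPartsDiv k ps))
  ≡⟨ ∑ₗ-applyUpTo (suc n) (λ ℓ → ℓ) (λ ℓ → ∑adm n ℓ (suc n) n (λ ps → + ovPartsDiv k ps)) ⟩
    ∑adm≤ n n (suc n) n (λ ps → + ovPartsDiv k ps) ∎
  where
  open ≡-Reasoning
  pos-if : ∀ {v} b → + (if b then v else 0) ≡ when b (+ v)
  pos-if true  = refl
  pos-if false = refl

-- Divisor sums

∑geom₁-coeff : ∀ r n (h : ℕ → ℕ) t → ∑geom₁ r (applyUpTo h n) t ≡ sumTo n (λ j → geom₁ (r * suc (h j)) t)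
∑geom₁-coeff r zero    h t = 𝟘-at t
∑geom₁-coeff r (suc n) h t = cong (λ s → geom₁ (r * suc (h 0)) t + s) (∑geom₁-coeff r n (λ j → h (suc j)) t)

divisor-swap : ∀ r .{{_ : NonZero r}} {t n} → t ≤ n →
  sumTo n (λ j → geom⁺With +_ (r * suc j) t) ≡ sumTo n (λ c → + suc c *ℤ geom⁺With (λ _ → + 1) (r * suc c) t)
divisor-swap r {t} {n} t≤n = begin
    sumTo n (λ j → geom⁺With +_ (r * suc j) t)
  ≡⟨ sumTo-cong n (λ j → geom⁺With-extend +_ (r * suc j) {{ℕ.m*n≢0 r (suc j)}} t≤n) ⟩
    sumTo n (λ j → sumTo n (λ c → [ r * suc j * suc c ≟ t ]· + suc c))
  ≡⟨ sumTo-comm n n (λ j c → [ r * suc j * suc c ≟ t ]· + suc c) ⟩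
    sumTo n (λ c → sumTo n (λ j → [ r * suc j * suc c ≟ t ]· + suc c))
  ≡⟨ sumTo-cong n (λ c → trans (sumTo-cong n (λ j → trans (cong (λ e → [ e ≟ t ]· + suc c) (swap j c))
                                                          (when-as-* (does (r * suc c * suc j ℕ.≟ t)) (+ suc c))))
                                (sumTo-*ˡ n (+ suc c) (λ j → [ r * suc c * suc j ≟ t ]· + 1))) ⟩
    sumTo n (λ c → + suc c *ℤ sumTo n (λ j → [ r * suc c * suc j ≟ t ]· + 1))
  ≡⟨ sumTo-cong n (λ c → cong (+ suc c *ℤ_) (sym (geom⁺With-extend (λ _ → + 1) (r * suc c) {{ℕ.m*n≢0 r (suc c)}} t≤n))) ⟩
    sumTo n (λ c → + suc c *ℤ geom⁺With (λ _ → + 1) (r * suc c) t) ∎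
  where
  open ≡-Reasoning
  swap : ∀ j c → r * suc j * suc c ≡ r * suc c * suc j
  swap j c = trans (ℕ.*-assoc r (suc j) (suc c))
                   (trans (cong (r *_) (ℕ.*-comm (suc j) (suc c))) (sym (ℕ.*-assoc r (suc c) (suc j))))

overlinedWeight-as-sum : ∀ k .{{_ : NonZero k}} {m n} X → 1 ≤ m → m ≤ n →
  overlinedWeight k m *ℤ X ≡ sumTo n (λ c → [ k * suc c ≟ m ]· (+ m *ℤ X))
overlinedWeight-as-sum k {m} {n} X 1≤m m≤n with k ∣? m
... | no k∤m = trans (ℤ.*-zeroˡ X) (sym (sumTo-zero n (λ c _ → [≟]-no {k * suc c} {m} (+ m *ℤ X)
      (λ eq → k∤m (divides (suc c) (trans (sym eq) (ℕ.*-comm k (suc c))))))))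
... | yes (divides zero    m≡0) = ⊥-elim (ℕ.<-irrefl (sym m≡0) 1≤m)
... | yes (divides (suc q) m≡qk) = sym (trans
      (sumTo-cong n (λ c → [≟]-⇔ {k * suc c} {m} (+ m *ℤ X) (mk⇔ to from)))
      (sumTo-[≟] {n} {q} (λ _ → + m *ℤ X) q<n))
  where
  to : ∀ {c} → k * suc c ≡ m → c ≡ q
  to {c} eq = ℕ.suc-injective (ℕ.*-cancelʳ-≡ (suc c) (suc q) k (trans (ℕ.*-comm (suc c) k) (trans eq m≡qk)))
  from : ∀ {c} → c ≡ q → k * suc c ≡ m
  from refl = trans (ℕ.*-comm k (suc q)) (sym m≡qk)
  q<n : q < n
  q<n = ℕ.<-≤-trans (ℕ.<-≤-trans (ℕ.n<1+n q) (ℕ.m≤m*n (suc q) k)) (subst (_≤ n) m≡qk m≤n)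

divisor-reindex : ∀ k .{{_ : NonZero k}} n (F : ℕ → ℤ) → (∀ m → n < m → F m ≡ + 0) →
  sumTo n (λ i → overlinedWeight k (suc i) *ℤ F (suc i)) ≡ sumTo n (λ c → + (k * suc c) *ℤ F (k * suc c))
divisor-reindex k n F F-vanishes = begin
    sumTo n (λ i → overlinedWeight k (suc i) *ℤ F (suc i))
  ≡⟨ sumTo-cong-< n (λ i i<n → overlinedWeight-as-sum k (F (suc i)) (s≤s z≤n) i<n) ⟩
    sumTo n (λ i → sumTo n (λ c → [ k * suc c ≟ suc i ]· G (suc i)))
  ≡⟨ sumTo-comm n n (λ i c → [ k * suc c ≟ suc i ]· G (suc i)) ⟩
    sumTo n (λ c → sumTo n (λ i → [ k * suc c ≟ suc i ]· G (suc i)))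
  ≡⟨ sumTo-cong n pick ⟩
    sumTo n (λ c → G (k * suc c)) ∎
  where
  open ≡-Reasoning
  G : ℕ → ℤ
  G m = + m *ℤ F m
  pick : ∀ c → sumTo n (λ i → [ k * suc c ≟ suc i ]· G (suc i)) ≡ G (k * suc c)
  pick c = decide (ℕ.pred K ℕ.<? n)
    where
    K : ℕ
    K = k * suc c
    suc-pred : suc (ℕ.pred K) ≡ K
    suc-pred = ℕ.suc-pred K {{ℕ.m*n≢0 k (suc c)}}
    reindexed : sumTo n (λ i → [ K ≟ suc i ]· G (suc i)) ≡ sumTo n (λ i → [ i ≟ ℕ.pred K ]· G (suc i))
    reindexed = sumTo-cong n (λ i → [≟]-⇔ {K} {suc i} (G (suc i))
                  (mk⇔ (λ K≡1+i → cong ℕ.pred (sym K≡1+i)) (λ { refl → sym suc-pred })))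
    decide : Dec (ℕ.pred K < n) → sumTo n (λ i → [ K ≟ suc i ]· G (suc i)) ≡ G K
    decide (yes p<n) = trans reindexed (trans (sumTo-[≟] (λ i → G (suc i)) p<n) (cong G suc-pred))
    decide (no  p≮n) = trans reindexed (trans (sumTo-[≟]-out (λ i → G (suc i)) (ℕ.≮⇒≥ p≮n))
      (sym (trans (cong (+ K *ℤ_) (F-vanishes K (subst (n <_) suc-pred (s≤s (ℕ.≮⇒≥ p≮n))))) (ℤ.*-zeroʳ (+ K)))))

∑geom₁-coeff-swapped : ∀ r .{{_ : NonZero r}} {t n} → t ≤ n →
  ∑geom₁ r (upTo n) t ≡ sumTo n (λ c → + suc c *ℤ geom⁺With (λ _ → + 1) (r * suc c) t)
∑geom₁-coeff-swapped r {t} {n} t≤n = trans (∑geom₁-coeff r n (λ j → j) t)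
  (trans (sumTo-cong n (λ j → geom₁-coeff (r * suc j) t)) (divisor-swap r t≤n))

module _ (k : ℕ) .{{_ : NonZero k}} where

  open WeightedGF (overlinedWeight k) altGeom (λ m → altGeom-spec (suc m))

  ov-as-coefficient : ∀ n → + ov k n ≡ (overpartitionGF n ⊛ overlinedWeightGF n) n
  ov-as-coefficient n = begin
      + ov k n
    ≡⟨ ov-as-∑adm≤ k n ⟩
      weigh n k n (suc n) n
    ≡⟨ weigh-unique n k admissibleGF weightedAdmissibleGF admissibleGF-expansion weightedAdmissibleGF-expansion
                    n n n ℕ.≤-refl ℕ.≤-refl ⟩
      (P ⊛ B ⊛ geom (suc n)) n
    ≡⟨ ⊛-trunc n {P ⊛ B} (λ _ _ → refl) (λ t t≤n → geom-below (suc n) t (s≤s t≤n)) ⟩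
      (P ⊛ B ⊛ 𝟙) n
    ≡⟨ trans (⊛-comm (P ⊛ B) 𝟙 n) (𝟙-⊛ (P ⊛ B) n) ⟩
      (P ⊛ B) n ∎
    where
    open ≡-Reasoning
    P B : PowerSeries
    P = overpartitionGF n
    B = overlinedWeightGF n

  overlinedWeightGF-coeff : ∀ a t → overlinedWeightGF a t ≡ sumTo a (λ i → overlinedWeight k (suc i) *ℤ altGeom (suc i) t)
  overlinedWeightGF-coeff zero    t = 𝟘-at t
  overlinedWeightGF-coeff (suc a) t = begin
      overlinedWeightGF a t + (constant (w (suc a)) ⊛ altGeom (suc a)) t
    ≡⟨ cong₂ _+_ (overlinedWeightGF-coeff a t) (constant-⊛ (w (suc a)) (altGeom (suc a)) t) ⟩
      sumTo a (λ i → w (suc i) *ℤ altGeom (suc i) t) + w (suc a) *ℤ altGeom (suc a) t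
    ≡⟨ sumTo-snoc a (λ i → w (suc i) *ℤ altGeom (suc i) t) ⟨
      sumTo (suc a) (λ i → w (suc i) *ℤ altGeom (suc i) t) ∎
    where
    open ≡-Reasoning
    w : ℕ → ℤ
    w = overlinedWeight k

  overlinedWeightGF-divisor-form : ∀ n t → t ≤ n →
    overlinedWeightGF n t ≡ + k *ℤ ∑geom₁ k (upTo n) t - + 2 *ℤ + k *ℤ ∑geom₁ (2 * k) (upTo n) t
  overlinedWeightGF-divisor-form n t t≤n = begin
      overlinedWeightGF n t
    ≡⟨ trans (overlinedWeightGF-coeff n t)
             (sumTo-cong n (λ i → cong (overlinedWeight k (suc i) *ℤ_) (altGeom-coeff (suc i) t))) ⟩
      sumTo n (λ i → overlinedWeight k (suc i) *ℤ F (suc i))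
    ≡⟨ divisor-reindex k n F F-vanishes ⟩
      sumTo n (λ c → + (k * suc c) *ℤ F (k * suc c))
    ≡⟨ sumTo-cong n split ⟩
      sumTo n (λ c → + k *ℤ (+ suc c *ℤ G (k * suc c)) + (- (+ 2 *ℤ + k)) *ℤ (+ suc c *ℤ G (2 * k * suc c)))
    ≡⟨ sumTo-linear₂ n (+ k) (- (+ 2 *ℤ + k)) (λ c → + suc c *ℤ G (k * suc c)) (λ c → + suc c *ℤ G (2 * k * suc c)) ⟩
      + k *ℤ sumTo n (λ c → + suc c *ℤ G (k * suc c)) + (- (+ 2 *ℤ + k)) *ℤ sumTo n (λ c → + suc c *ℤ G (2 * k * suc c))
    ≡⟨ cong₂ (λ u v → + k *ℤ u + (- (+ 2 *ℤ + k)) *ℤ v)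
             (sym (∑geom₁-coeff-swapped k t≤n)) (sym (∑geom₁-coeff-swapped (2 * k) {{ℕ.m*n≢0 2 k}} t≤n)) ⟩
      + k *ℤ ∑geom₁ k (upTo n) t + (- (+ 2 *ℤ + k)) *ℤ ∑geom₁ (2 * k) (upTo n) t
    ≡⟨ negate-coefficient (+ k) (∑geom₁ k (upTo n) t) (∑geom₁ (2 * k) (upTo n) t) ⟩
      + k *ℤ ∑geom₁ k (upTo n) t - + 2 *ℤ + k *ℤ ∑geom₁ (2 * k) (upTo n) t ∎
    where
    open ≡-Reasoning
    G F : ℕ → ℤ
    G m = geom⁺With (λ _ → + 1) m t
    F m = G m - + 2 *ℤ G (2 * m)
    F-vanishes : ∀ m → n < m → F m ≡ + 0
    F-vanishes m n<m = cong₂ (λ u v → u - + 2 *ℤ v)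
      (geom⁺-vanishes m t (ℕ.≤-<-trans t≤n n<m))
      (geom⁺-vanishes (2 * m) t (ℕ.<-≤-trans (ℕ.≤-<-trans t≤n n<m) (ℕ.m≤n*m m 2)))
    split : ∀ c → + (k * suc c) *ℤ F (k * suc c)
                ≡ + k *ℤ (+ suc c *ℤ G (k * suc c)) + (- (+ 2 *ℤ + k)) *ℤ (+ suc c *ℤ G (2 * k * suc c))
    split c = trans (cong₂ (λ u v → u *ℤ (G (k * suc c) - + 2 *ℤ G v))
                           (ℤ.pos-* k (suc c)) (sym (ℕ.*-assoc 2 k (suc c))))
                    (distribute (+ k) (+ suc c) (G (k * suc c)) (G (2 * k * suc c)))
      where
      distribute : ∀ a b x y → a *ℤ b *ℤ (x - + 2 *ℤ y) ≡ a *ℤ (b *ℤ x) + (- (+ 2 *ℤ a)) *ℤ (b *ℤ y)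
      distribute = solve-∀
    negate-coefficient : ∀ a x y → a *ℤ x + (- (+ 2 *ℤ a)) *ℤ y ≡ a *ℤ x - + 2 *ℤ a *ℤ y
    negate-coefficient = solve-∀

  ov-divisor-form : ∀ n → + ov k n ≡ (∏overpartitionFactor (upTo n) ⊛
    (λ t → + k *ℤ ∑geom₁ k (upTo n) t - + 2 *ℤ + k *ℤ ∑geom₁ (2 * k) (upTo n) t)) n
  ov-divisor-form n = trans (ov-as-coefficient n)
    (⊛-trunc n {overpartitionGF n} {∏overpartitionFactor (upTo n)} {overlinedWeightGF n}
               {λ t → + k *ℤ ∑geom₁ k (upTo n) t - + 2 *ℤ + k *ℤ ∑geom₁ (2 * k) (upTo n) t}
               (λ i _ → overpartitionGF≗∏overpartitionFactor n i) (overlinedWeightGF-divisor-form n))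

mainTheorem4 : (k n : ℕ) → 1 ≤ k →
    (+ 2) *ℤ (+ ov k n) ≡ (+ k) *ℤ M2 k n - (+ 2) *ℤ (+ k) *ℤ M2 (2 * k) n
mainTheorem4 k@(suc _) n _ = begin
    + 2 *ℤ + ov k n
  ≡⟨ cong (+ 2 *ℤ_) (trans (ov-divisor-form k n) (⊛-linearʳ ∏ H H′ (+ k) (+ 2 *ℤ + k) n)) ⟩
    + 2 *ℤ (+ k *ℤ (∏ ⊛ H) n - + 2 *ℤ + k *ℤ (∏ ⊛ H′) n)
  ≡⟨ double (+ k) ((∏ ⊛ H) n) ((∏ ⊛ H′) n) ⟩
    + k *ℤ ((∏ ⊛ H) n + (∏ ⊛ H) n) - + 2 *ℤ + k *ℤ ((∏ ⊛ H′) n + (∏ ⊛ H′) n)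
  ≡⟨ cong₂ (λ u v → + k *ℤ u - + 2 *ℤ + k *ℤ v)
           (sym (trans (M2-formula k n) (⊛-distribˡ-⊕ ∏ H H n)))
           (sym (trans (M2-formula (2 * k) n) (⊛-distribˡ-⊕ ∏ H′ H′ n))) ⟩
    + k *ℤ M2 k n - + 2 *ℤ + k *ℤ M2 (2 * k) n ∎
  where
  open ≡-Reasoning
  ∏ H H′ : PowerSeries
  ∏  = ∏overpartitionFactor (upTo n)
  H  = ∑geom₁ k (upTo n)
  H′ = ∑geom₁ (2 * k) (upTo n)
  double : ∀ a x y → + 2 *ℤ (a *ℤ x - + 2 *ℤ a *ℤ y) ≡ a *ℤ (x + x) - + 2 *ℤ a *ℤ (y + y)
  double = solve-∀
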